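{- For $n\ge1$, $$|\Pi_n(12/34)|=\sum_{k=0}^{\lfloor n/2\rfloor}\left[k!\binom{n}{2k}+\sum_{\ell=3}^{n-2k}\binom{n}{2k+\ell}k!\,(k+1)^2\right],$$ where an empty inner sum is $0$.
   Context: The standardization of a set partition of a finite set $S\subset\mathbb{Z}_{>0}$ replaces the $i$-th smallest element of $S$ by $i$. A set partition $\pi$ of $[n]$ contains $\tau\vdash[k]$ if for some $S\subseteq[n]$ the standardization of the restriction of $\pi$ to $S$ is $\tau$; otherwise it avoids $\tau$. $\Pi_n(\tau)$ is the set of partitions of $[n]$ avoiding $\tau$. $12/34$ is the partition of $[4]$ with blocks $\{1,2\},\{3,4\}$. -}

module Defs where

open import Data.Nat using (ℕ; zero; suc; _+_; _*_; _∸_; _<_)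
open import Data.Fin using (Fin; toℕ)
import Data.Fin as F
open import Data.Vec using (Vec; lookup)
open import Data.Bool using (Bool; T)
open import Data.List using (List; map; upTo)
open import Data.Nat.ListAction using (sum)
open import Data.Product using (Σ; _×_)
open import Relation.Binary.PropositionalEquality using (_≡_)
open import Function.Bundles using (_⇔_)

-- A binary relation on [n] = Fin n (element i of Fin n stands for i+1),
-- stored as an n×n Boolean matrix (so that equality is decidable/propositional).
RelMat : ℕ → Set
RelMat n = Vec (Vec Bool n) n

_∼[_]_ : {n : ℕ} → Fin n → RelMat n → Fin n → Set
i ∼[ M ] j = T (lookup (lookup M i) j)

-- A set partition of [n] is encoded by its "same block" relation,
-- which is exactly an equivalence relation on [n].
IsSetPartition : {n : ℕ} → RelMat n → Set
IsSetPartition {n} M =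
  ((i : Fin n) → i ∼[ M ] i) ×
  ((i j : Fin n) → i ∼[ M ] j → j ∼[ M ] i) ×
  ((i j l : Fin n) → i ∼[ M ] j → j ∼[ M ] l → i ∼[ M ] l)

-- Strictly increasing maps Fin k → Fin n (= k-element subsets S of [n],
-- with f i the (i+1)-st smallest element of S).
StrictlyIncreasing : {k n : ℕ} → (Fin k → Fin n) → Set
StrictlyIncreasing {k} f = (i j : Fin k) → toℕ i < toℕ j → toℕ (f i) < toℕ (f j)

-- π (same-block relation M on [n]) contains the pattern τ (same-block relation on [k]):
-- some S ⊆ [n] whose restriction, standardized, equals τ.
Contains : {n k : ℕ} → RelMat n → (Fin k → Fin k → Set) → Set
Contains {n} {k} M τ =
  Σ (Fin k → Fin n) λ f → StrictlyIncreasing f ×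
    ((i j : Fin k) → (f i ∼[ M ] f j) ⇔ τ i j)

Avoids : {n k : ℕ} → RelMat n → (Fin k → Fin k → Set) → Set
Avoids M τ = Contains M τ → Data.Empty.⊥
  where import Data.Empty

block-12/34 : Fin 4 → ℕ
block-12/34 F.zero = 0
block-12/34 (F.suc F.zero) = 0
block-12/34 (F.suc (F.suc F.zero)) = 1
block-12/34 (F.suc (F.suc (F.suc F.zero))) = 1

p12/34 : Fin 4 → Fin 4 → Set
p12/34 i j = block-12/34 i ≡ block-12/34 j

-- Σ_{i=a}^{b} f i, empty (= 0) when b < a.
sumFromTo : ℕ → ℕ → (ℕ → ℕ) → ℕ
sumFromTo a b f = sum (map (λ i → f (a + i)) (upTo (suc b ∸ a)))

module Submission where

-- Call an element of a non-singleton block an opener, a middle or a closer according as its block contains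
-- only larger, both larger and smaller, or only smaller elements. Avoiding 12/34 means exactly that if x has a
-- smaller block-mate and y > x has a larger one, then x and y share a block. Hence, listed increasingly, the
-- union S of the non-singleton blocks consists of all openers (one per block), then the middles, which all lie
-- in a single block, then all closers (one per block). So the partition is determined by S, the bijection
-- between closers and openers, and the block of the middles. With k blocks of size two this leaves
-- (n choose 2k)·k! partitions; with k + 1 blocks, one of size l ≥ 3, it leaves
-- (n choose 2k + l)·(k + 1)!·(k + 1) = (n choose 2k + l)·k!·(k + 1)² partitions.

open import Defs
open import Data.Nat using (ℕ; suc; _!; _+_; _*_; _∸_; _^_; _≤_)
open import Data.Nat.DivMod using (_/_)
open import Data.Nat.Combinatorics using (_C_)
open import Data.List using (List; length)
open import Data.List.Relation.Unary.Unique.Propositional using (Unique)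
open import Data.List.Membership.Propositional using (_∈_)
open import Data.Product using (Σ; _×_)
open import Relation.Binary.PropositionalEquality using (_≡_)
open import Function.Bundles using (_⇔_)

open import Data.Nat
open import Data.Nat.Properties
open import Data.Nat.DivMod using (m*n/n≡m; /-monoˡ-≤)
open import Data.Nat.Combinatorics using (nCk+nC[k+1]≡[n+1]C[k+1])
open import Data.Nat.ListAction using (sum)
open import Data.Nat.Tactic.RingSolver using (solve-∀)
open import Data.Bool using (Bool; true; false; if_then_else_; T; _∨_; _∧_; not)
open import Data.Bool.Properties using (T-≡; ∨-zeroʳ)
open import Data.Fin as F using (Fin; toℕ; fromℕ<; punchIn; punchOut)
open import Data.Fin.Properties
  using (toℕ-fromℕ<; toℕ-injective; toℕ<n; fromℕ<-toℕ; injective⇒≤;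
         punchIn-injective; punchInᵢ≢i; punchOut-injective; punchIn-punchOut)
  renaming (suc-injective to suc-injectiveᶠ)
open import Data.Vec as V using (Vec; []; _∷_; lookup; tabulate)
open import Data.Vec.Properties using (lookup-map; lookup∘tabulate; tabulate∘lookup; tabulate-cong; ∷-injectiveʳ)
open import Data.List using ([]; _∷_; map; concatMap; _++_; allFin; upTo)
open import Data.List.Properties using (length-++; length-map; length-tabulate; map-cong)
open import Data.List.Relation.Unary.All as All using (All; []; _∷_)
open import Data.List.Relation.Unary.Any as Any using (here; there)
open import Data.List.Relation.Unary.AllPairs using ([]; _∷_)
open import Data.List.Relation.Unary.Unique.Propositional.Properties using (++⁺; map⁺; allFin⁺; upTo⁺)
open import Data.List.Membership.Propositional using (find)
open import Data.List.Membership.Propositional.Properties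
  using (∈-++⁻; ∈-++⁺ˡ; ∈-++⁺ʳ; ∈-map⁺; ∈-map⁻; ∈-concatMap⁺; ∈-concatMap⁻; ∈-allFin; ∈-upTo⁺)
open import Data.Product using (_,_; proj₁; proj₂)
open import Data.Sum using (_⊎_; inj₁; inj₂)
open import Data.Empty using (⊥; ⊥-elim)
open import Relation.Nullary using (¬_; yes; no; Dec)
open import Relation.Nullary.Decidable using (⌊_⌋; toWitness; fromWitness; isYes≗does; dec-true; dec-false)
open import Relation.Binary using (Tri; tri<; tri≈; tri>)
open import Relation.Binary.PropositionalEquality
open import Function using (_∘_; _∘′_; case_of_)
open import Function.Bundles using (Equivalence; mk⇔)
open import Function.Properties.Equivalence using () renaming (sym to ⇔-sym; trans to ⇔-trans)

private
  variable
    A B : Set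

module Counting where

  𝟙 : Bool → ℕ
  𝟙 true = 1
  𝟙 false = 0

  count : (ℕ → Bool) → ℕ → ℕ
  count P zero = 0
  count P (suc x) = count P x + 𝟙 (P x)

  count-mono : ∀ P {x} y → x ≤ y → count P x ≤ count P y
  count-mono P zero z≤n = ≤-refl
  count-mono P (suc y) x≤1+y with m≤n⇒m<n∨m≡n x≤1+y
  ... | inj₂ refl = ≤-refl
  ... | inj₁ x<1+y = ≤-trans (count-mono P y (≤-pred x<1+y)) (m≤m+n _ _)

  count-strict : ∀ P {x y} → P x ≡ true → x < y → count P x < count P y
  count-strict P {x} {y} Px x<y = ≤-trans count-step (count-mono P y x<y)
    where
    count-step : count P x < count P (suc x)
    count-step rewrite Px = m<m+n (count P x) (s≤s z≤n)

  count-injective : ∀ P {x y} → P x ≡ true → P y ≡ true → count P x ≡ count P y → x ≡ y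
  count-injective P {x} {y} Px Py eq with <-cmp x y
  ... | tri< x<y _ _ = ⊥-elim (<-irrefl eq (count-strict P Px x<y))
  ... | tri≈ _ x≡y _ = x≡y
  ... | tri> _ _ y<x = ⊥-elim (<-irrefl (sym eq) (count-strict P Py y<x))

  count≤ : ∀ P x → count P x ≤ x
  count≤ P zero = z≤n
  count≤ P (suc x) = ≤-trans (+-mono-≤ (count≤ P x) (𝟙≤1 (P x))) (≤-reflexive (+-comm x 1))
    where
    𝟙≤1 : ∀ b → 𝟙 b ≤ 1
    𝟙≤1 true = ≤-refl
    𝟙≤1 false = z≤n

  count-select : ∀ P n r → r < count P n → Σ ℕ λ x → x < n × P x ≡ true × count P x ≡ r
  count-select P (suc n) r r<count with r <? count P n
  ... | yes r<count′ with count-select P n r r<count′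
  ...   | x , x<n , Px , count≡r = x , m<n⇒m<1+n x<n , Px , count≡r
  count-select P (suc n) r r<count | no r≮count with P n in Pn
  ... | true = n , n<1+n n , Pn , ≤-antisym (≮⇒≥ r≮count) (≤-pred (≤-trans r<count (≤-reflexive (+-comm (count P n) 1))))
  ... | false = ⊥-elim (r≮count (≤-trans r<count (≤-reflexive (+-identityʳ _))))

  count-cong : ∀ P Q x → (∀ y → y < x → P y ≡ Q y) → count P x ≡ count Q x
  count-cong P Q zero _ = refl
  count-cong P Q (suc x) P≗Q =
    cong₂ _+_ (count-cong P Q x (λ y y<x → P≗Q y (m<n⇒m<1+n y<x))) (cong 𝟙 (P≗Q x (n<1+n x)))

  count-none : ∀ P x → (∀ y → y < x → P y ≡ false) → count P x ≡ 0
  count-none P zero _ = refl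
  count-none P (suc x) none rewrite none x (n<1+n x) | count-none P x (λ y y<x → none y (m<n⇒m<1+n y<x)) = refl

  count-+ : ∀ P Q R x → (∀ y → 𝟙 (P y) ≡ 𝟙 (Q y) + 𝟙 (R y)) → count P x ≡ count Q x + count R x
  count-+ P Q R zero _ = refl
  count-+ P Q R (suc x) split rewrite count-+ P Q R x split | split x =
    +-assoc-comm (count Q x) (count R x) (𝟙 (Q x)) (𝟙 (R x))
    where
    +-assoc-comm : ∀ a b c d → a + b + (c + d) ≡ a + c + (b + d)
    +-assoc-comm = solve-∀

  count-stable : ∀ P x n → x ≤ n → (∀ y → x ≤ y → y < n → P y ≡ false) → count P x ≡ count P n
  count-stable P x zero z≤n _ = refl
  count-stable P x (suc n) x≤1+n none with m≤n⇒m<n∨m≡n x≤1+n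
  ... | inj₂ refl = refl
  ... | inj₁ x<1+n rewrite none n (≤-pred x<1+n) (n<1+n n) =
    trans (count-stable P x n (≤-pred x<1+n) (λ y x≤y y<n → none y x≤y (m<n⇒m<1+n y<n))) (sym (+-identityʳ _))

  count-≤-injection : ∀ P Q n (φ : ℕ → ℕ) →
    (∀ x → x < n → P x ≡ true → φ x < n × Q (φ x) ≡ true) →
    (∀ x y → P x ≡ true → P y ≡ true → φ x ≡ φ y → x ≡ y) →
    count P n ≤ count Q n
  count-≤-injection P Q n φ φ-maps φ-injective = injective⇒≤ {f = h} h-injective
    where
    h : Fin (count P n) → Fin (count Q n)
    h r with count-select P n (toℕ r) (toℕ<n r)
    ... | x , x<n , Px , _ = fromℕ< (count-strict Q (proj₂ (φ-maps x x<n Px)) (proj₁ (φ-maps x x<n Px)))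
    h-injective : ∀ {r r′} → h r ≡ h r′ → r ≡ r′
    h-injective {r} {r′} hr≡hr′ with count-select P n (toℕ r) (toℕ<n r) | count-select P n (toℕ r′) (toℕ<n r′)
    ... | x , x<n , Px , rank-x | x′ , x′<n , Px′ , rank-x′ = toℕ-injective (begin
      toℕ r      ≡⟨ rank-x ⟨
      count P x    ≡⟨ cong (count P) (φ-injective x x′ Px Px′ φx≡φx′) ⟩
      count P x′   ≡⟨ rank-x′ ⟩
      toℕ r′     ∎)
      where
      open ≡-Reasoning
      φx≡φx′ : φ x ≡ φ x′
      φx≡φx′ = count-injective Q (proj₂ (φ-maps x x<n Px)) (proj₂ (φ-maps x′ x′<n Px′))
        (trans (sym (toℕ-fromℕ< _)) (trans (cong toℕ hr≡hr′) (toℕ-fromℕ< _)))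

  anyBelow : (ℕ → Bool) → ℕ → Bool
  anyBelow P zero = false
  anyBelow P (suc x) = anyBelow P x ∨ P x

  anyBelow-intro : ∀ P x y → y < x → P y ≡ true → anyBelow P x ≡ true
  anyBelow-intro P (suc x) y y<1+x Py with m≤n⇒m<n∨m≡n (≤-pred y<1+x)
  ... | inj₁ y<x rewrite anyBelow-intro P x y y<x Py = refl
  ... | inj₂ refl rewrite Py = ∨-zeroʳ (anyBelow P x)

  anyBelow-elim : ∀ P x → anyBelow P x ≡ true → Σ ℕ λ y → y < x × P y ≡ true
  anyBelow-elim P (suc x) hit with anyBelow P x in anyx
  ... | true with anyBelow-elim P x anyx
  ...   | y , y<x , Py = y , m<n⇒m<1+n y<x , Py
  anyBelow-elim P (suc x) Px | false = x , n<1+n x , Px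

  anyBelow-none : ∀ P x → anyBelow P x ≡ false → ∀ y → y < x → P y ≡ false
  anyBelow-none P x none y y<x with P y in Py
  ... | false = refl
  ... | true = trans (sym (anyBelow-intro P x y y<x Py)) none

  least : (ℕ → Bool) → ℕ → ℕ
  least P zero = zero
  least P (suc n) = if anyBelow P n then least P n else n

  least-spec : ∀ P n y → y < n → P y ≡ true →
    least P n ≤ y × P (least P n) ≡ true × (∀ z → z < least P n → P z ≡ false)
  least-spec P (suc n) y y<1+n Py with anyBelow P n in anyn | m≤n⇒m<n∨m≡n (≤-pred y<1+n)
  ... | true | inj₁ y<n = least-spec P n y y<n Py
  ... | true | inj₂ refl with anyBelow-elim P n anyn
  ...   | w , w<n , Pw with least-spec P n w w<n Pw
  ...     | least≤w , rest = ≤-trans least≤w (<⇒≤ w<n) , rest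
  least-spec P (suc n) y y<1+n Py | false | inj₁ y<n with () ← trans (sym (anyBelow-none P n anyn y y<n)) Py
  least-spec P (suc n) y y<1+n Py | false | inj₂ refl = ≤-refl , Py , anyBelow-none P n anyn

  greatest : (ℕ → Bool) → ℕ → ℕ
  greatest P zero = zero
  greatest P (suc n) = if P n then n else greatest P n

  greatest-spec : ∀ P n y → y < n → P y ≡ true → y ≤ greatest P n × greatest P n < n × P (greatest P n) ≡ true
  greatest-spec P (suc n) y y<1+n Py with P n in Pn | m≤n⇒m<n∨m≡n (≤-pred y<1+n)
  ... | true | _ = ≤-pred y<1+n , n<1+n n , Pn
  ... | false | inj₂ refl with () ← trans (sym Pn) Py
  ... | false | inj₁ y<n with greatest-spec P n y y<n Py
  ...   | y≤greatest , greatest<n , Pgreatest = y≤greatest , m<n⇒m<1+n greatest<n , Pgreatest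

module ListProperties where

  Unique-map-injectiveOn : ∀ (f : A → B) {xs} → Unique xs →
    (∀ {x y} → x ∈ xs → y ∈ xs → f x ≡ f y → x ≡ y) → Unique (map f xs)
  Unique-map-injectiveOn f {[]} [] _ = []
  Unique-map-injectiveOn f {x ∷ xs} (x∉xs ∷ uniq) inj =
    distinct xs x∉xs (λ m → m) ∷ Unique-map-injectiveOn f uniq (λ p q → inj (there p) (there q))
    where
    distinct : ∀ ys → All (x ≢_) ys → (∀ {y} → y ∈ ys → y ∈ xs) → All (f x ≢_) (map f ys)
    distinct [] [] _ = []
    distinct (y ∷ ys) (x≢y ∷ rest) ⊆xs =
      (λ fx≡fy → x≢y (inj (here refl) (there (⊆xs (here refl))) fx≡fy)) ∷ distinct ys rest (λ m → ⊆xs (there m))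

  Unique-concatMap : ∀ (g : A → List B) {xs} → Unique xs → (∀ {x} → x ∈ xs → Unique (g x)) →
    (∀ {x y z} → x ∈ xs → y ∈ xs → z ∈ g x → z ∈ g y → x ≡ y) → Unique (concatMap g xs)
  Unique-concatMap g {[]} [] _ _ = []
  Unique-concatMap g {x ∷ xs} (x∉xs ∷ uniq) uniqᵍ disjoint =
    ++⁺ (uniqᵍ (here refl))
        (Unique-concatMap g uniq (λ m → uniqᵍ (there m)) (λ p q → disjoint (there p) (there q)))
        apart
    where
    apart : ∀ {z} → z ∈ g x × z ∈ concatMap g xs → ⊥
    apart (z∈gx , z∈rest) with find (∈-concatMap⁻ g z∈rest)
    ... | y , y∈xs , z∈gy = All.lookup x∉xs y∈xs (disjoint (here refl) (there y∈xs) z∈gx z∈gy)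

  Unique-concatMap-keyed : ∀ (g : A → List B) (key : B → A) {xs} → Unique xs → (∀ {x} → x ∈ xs → Unique (g x)) →
    (∀ {x z} → x ∈ xs → z ∈ g x → key z ≡ x) → Unique (concatMap g xs)
  Unique-concatMap-keyed g key uniq uniqᵍ key-spec =
    Unique-concatMap g uniq uniqᵍ (λ x∈ y∈ z∈gx z∈gy → trans (sym (key-spec x∈ z∈gx)) (key-spec y∈ z∈gy))

  ∈-concatMap-intro : ∀ (g : A → List B) {xs x y} → x ∈ xs → y ∈ g x → y ∈ concatMap g xs
  ∈-concatMap-intro g {xs} x∈xs y∈gx = ∈-concatMap⁺ g {xs = xs} (Any.map (λ { refl → y∈gx }) x∈xs)

  length-concatMap : ∀ (g : A → List B) xs → length (concatMap g xs) ≡ sum (map (length ∘′ g) xs)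
  length-concatMap g [] = refl
  length-concatMap g (x ∷ xs) = trans (length-++ (g x)) (cong (length (g x) +_) (length-concatMap g xs))

  length-concatMap-const : ∀ (g : A → List B) xs c → (∀ {x} → x ∈ xs → length (g x) ≡ c) →
    length (concatMap g xs) ≡ length xs * c
  length-concatMap-const g [] c _ = refl
  length-concatMap-const g (x ∷ xs) c len≡c =
    trans (length-++ (g x)) (cong₂ _+_ (len≡c (here refl)) (length-concatMap-const g xs c (λ m → len≡c (there m))))

  lookup-extensionality : ∀ {n} (u v : Vec A n) → (∀ i → lookup u i ≡ lookup v i) → u ≡ v
  lookup-extensionality u v u≗v = trans (sym (tabulate∘lookup u)) (trans (tabulate-cong u≗v) (tabulate∘lookup v))

open Counting
open ListProperties

module Subsets where

  weight : ∀ {n} → Vec Bool n → ℕ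
  weight [] = 0
  weight (b ∷ v) = 𝟙 b + weight v

  member : ∀ {n} → Vec Bool n → ℕ → Bool
  member [] _ = false
  member (b ∷ v) zero = b
  member (b ∷ v) (suc x) = member v x

  member-lookup : ∀ {n} (S : Vec Bool n) i → member S (toℕ i) ≡ lookup S i
  member-lookup (b ∷ S) F.zero = refl
  member-lookup (b ∷ S) (F.suc i) = member-lookup S i

  member⇒< : ∀ {n} (S : Vec Bool n) x → member S x ≡ true → x < n
  member⇒< (b ∷ S) zero _ = s≤s z≤n
  member⇒< (b ∷ S) (suc x) x∈S = s≤s (member⇒< S x x∈S)

  member-tabulate : ∀ {n} (P : ℕ → Bool) x → x < n → member (tabulate {n = n} (λ j → P (toℕ j))) x ≡ P x
  member-tabulate {suc n} P zero _ = refl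
  member-tabulate {suc n} P (suc x) (s≤s x<n) = member-tabulate {n} (λ y → P (suc y)) x x<n

  count-member : ∀ {n} (S : Vec Bool n) → count (member S) n ≡ weight S
  count-member [] = refl
  count-member {suc n} (b ∷ S) = trans (count-shift (member (b ∷ S)) n) (cong (𝟙 b +_) (count-member S))
    where
    count-shift : ∀ P n → count P (suc n) ≡ 𝟙 (P 0) + count (λ x → P (suc x)) n
    count-shift P zero = sym (+-identityʳ _)
    count-shift P (suc n) rewrite count-shift P n = +-assoc (𝟙 (P 0)) _ _

  weight≤ : ∀ {n} (S : Vec Bool n) → weight S ≤ n
  weight≤ {n} S = subst (_≤ n) (count-member S) (count≤ (member S) n)

  rank : ∀ {n} → Vec Bool n → ℕ → ℕ
  rank S = count (member S)

  rank<weight : ∀ {n} (S : Vec Bool n) x → member S x ≡ true → rank S x < weight S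
  rank<weight {n} S x x∈S = subst (rank S x <_) (count-member S) (count-strict (member S) x∈S (member⇒< S x x∈S))

  subsets : (n m : ℕ) → List (Vec Bool n)
  subsets zero zero = [] ∷ []
  subsets zero (suc m) = []
  subsets (suc n) zero = map (false ∷_) (subsets n zero)
  subsets (suc n) (suc m) = map (true ∷_) (subsets n m) ++ map (false ∷_) (subsets n (suc m))

  length-subsets : ∀ n m → length (subsets n m) ≡ n C m
  length-subsets zero zero = refl
  length-subsets zero (suc m) = refl
  length-subsets (suc n) zero = trans (length-map _ (subsets n zero)) (length-subsets n zero)
  length-subsets (suc n) (suc m) = begin
    length (map (true ∷_) (subsets n m) ++ map (false ∷_) (subsets n (suc m)))
      ≡⟨ length-++ (map (true ∷_) (subsets n m)) ⟩
    length (map (true ∷_) (subsets n m)) + length (map (false ∷_) (subsets n (suc m)))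
      ≡⟨ cong₂ _+_ (length-map _ (subsets n m)) (length-map _ (subsets n (suc m))) ⟩
    length (subsets n m) + length (subsets n (suc m))
      ≡⟨ cong₂ _+_ (length-subsets n m) (length-subsets n (suc m)) ⟩
    n C m + n C suc m
      ≡⟨ nCk+nC[k+1]≡[n+1]C[k+1] n m ⟩
    suc n C suc m ∎
    where open ≡-Reasoning

  ∈-subsets⁻ : ∀ n m v → v ∈ subsets n m → weight v ≡ m
  ∈-subsets⁻ zero zero [] _ = refl
  ∈-subsets⁻ (suc n) zero (b ∷ v) v∈ with ∈-map⁻ (false ∷_) v∈
  ... | w , w∈ , refl = ∈-subsets⁻ n zero w w∈
  ∈-subsets⁻ (suc n) (suc m) (b ∷ v) v∈ with ∈-++⁻ (map (true ∷_) (subsets n m)) v∈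
  ... | inj₁ v∈ˡ with ∈-map⁻ (true ∷_) v∈ˡ
  ...   | w , w∈ , refl = cong suc (∈-subsets⁻ n m w w∈)
  ∈-subsets⁻ (suc n) (suc m) (b ∷ v) v∈ | inj₂ v∈ʳ with ∈-map⁻ (false ∷_) v∈ʳ
  ...   | w , w∈ , refl = ∈-subsets⁻ n (suc m) w w∈

  ∈-subsets⁺ : ∀ n m v → weight v ≡ m → v ∈ subsets n m
  ∈-subsets⁺ zero zero [] _ = here refl
  ∈-subsets⁺ (suc n) zero (false ∷ v) w≡0 = ∈-map⁺ (false ∷_) (∈-subsets⁺ n zero v w≡0)
  ∈-subsets⁺ (suc n) (suc m) (true ∷ v) refl = ∈-++⁺ˡ (∈-map⁺ (true ∷_) (∈-subsets⁺ n m v refl))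
  ∈-subsets⁺ (suc n) (suc m) (false ∷ v) w≡m =
    ∈-++⁺ʳ (map (true ∷_) (subsets n m)) (∈-map⁺ (false ∷_) (∈-subsets⁺ n (suc m) v w≡m))

  Unique-subsets : ∀ n m → Unique (subsets n m)
  Unique-subsets zero zero = [] ∷ []
  Unique-subsets zero (suc m) = []
  Unique-subsets (suc n) zero = map⁺ ∷-injectiveʳ (Unique-subsets n zero)
  Unique-subsets (suc n) (suc m) =
    ++⁺ (map⁺ ∷-injectiveʳ (Unique-subsets n m)) (map⁺ ∷-injectiveʳ (Unique-subsets n (suc m))) apart
    where
    apart : ∀ {v} → v ∈ map (true ∷_) (subsets n m) × v ∈ map (false ∷_) (subsets n (suc m)) → ⊥
    apart (v∈ˡ , v∈ʳ) with ∈-map⁻ (true ∷_) v∈ˡ | ∈-map⁻ (false ∷_) v∈ʳ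
    ... | _ , _ , refl | _ , _ , ()

module Permutations where

  Injectiveᵛ : ∀ {f} → Vec (Fin f) f → Set
  Injectiveᵛ {f} v = ∀ i j → lookup v i ≡ lookup v j → i ≡ j

  Surjectiveᵛ : ∀ {f} → Vec (Fin f) f → Set
  Surjectiveᵛ {f} v = ∀ y → Σ (Fin f) λ i → lookup v i ≡ y

  insertAt : ∀ {f} → Fin (suc f) → Vec (Fin f) f → Vec (Fin (suc f)) (suc f)
  insertAt a w = a ∷ V.map (punchIn a) w

  permutations : (f : ℕ) → List (Vec (Fin f) f)
  permutations zero = [] ∷ []
  permutations (suc f) = concatMap (λ a → map (insertAt a) (permutations f)) (allFin (suc f))

  length-permutations : ∀ f → length (permutations f) ≡ f !
  length-permutations zero = refl
  length-permutations (suc f) =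
    trans (length-concatMap-const (λ a → map (insertAt a) (permutations f)) (allFin (suc f)) (f !)
            (λ _ → trans (length-map _ (permutations f)) (length-permutations f)))
          (cong (_* f !) (length-tabulate {n = suc f} (λ a → a)))

  insertAt-injective : ∀ {f} a (w : Vec (Fin f) f) → Injectiveᵛ w → Injectiveᵛ (insertAt a w)
  insertAt-injective a w inj F.zero F.zero _ = refl
  insertAt-injective a w inj F.zero (F.suc j) eq rewrite lookup-map j (punchIn a) w =
    ⊥-elim (punchInᵢ≢i a (lookup w j) (sym eq))
  insertAt-injective a w inj (F.suc i) F.zero eq rewrite lookup-map i (punchIn a) w =
    ⊥-elim (punchInᵢ≢i a (lookup w i) eq)
  insertAt-injective a w inj (F.suc i) (F.suc j) eq rewrite lookup-map i (punchIn a) w | lookup-map j (punchIn a) w =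
    cong F.suc (inj i j (punchIn-injective a _ _ eq))

  insertAt-surjective : ∀ {f} a (w : Vec (Fin f) f) → Surjectiveᵛ w → Surjectiveᵛ (insertAt a w)
  insertAt-surjective a w surj y with a F.≟ y
  ... | yes refl = F.zero , refl
  ... | no a≢y with surj (punchOut a≢y)
  ...   | i , wi≡ = F.suc i , trans (lookup-map i (punchIn a) w) (trans (cong (punchIn a) wi≡) (punchIn-punchOut a≢y))

  ∈-permutations-insertAt : ∀ {f v} → v ∈ permutations (suc f) →
    Σ (Fin (suc f)) λ a → Σ (Vec (Fin f) f) λ w → w ∈ permutations f × v ≡ insertAt a w
  ∈-permutations-insertAt {f} v∈ with find (∈-concatMap⁻ (λ a → map (insertAt a) (permutations f)) {xs = allFin (suc f)} v∈)
  ... | a , _ , v∈a with ∈-map⁻ (insertAt a) v∈a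
  ...   | w , w∈ , v≡ = a , w , w∈ , v≡

  ∈-permutations⇒injective : ∀ f v → v ∈ permutations f → Injectiveᵛ v
  ∈-permutations⇒injective zero [] _ ()
  ∈-permutations⇒injective (suc f) v v∈ with ∈-permutations-insertAt v∈
  ... | a , w , w∈ , refl = insertAt-injective a w (∈-permutations⇒injective f w w∈)

  ∈-permutations⇒surjective : ∀ f v → v ∈ permutations f → Surjectiveᵛ v
  ∈-permutations⇒surjective zero [] _ ()
  ∈-permutations⇒surjective (suc f) v v∈ with ∈-permutations-insertAt v∈
  ... | a , w , w∈ , refl = insertAt-surjective a w (∈-permutations⇒surjective f w w∈)

  injective⇒∈-permutations : ∀ f v → Injectiveᵛ v → v ∈ permutations f
  injective⇒∈-permutations zero [] _ = here refl
  injective⇒∈-permutations (suc f) (a ∷ t) inj =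
    ∈-concatMap-intro (λ a → map (insertAt a) (permutations f)) (∈-allFin a)
      (subst (_∈ map (insertAt a) (permutations f)) insertAt-w≡
        (∈-map⁺ (insertAt a) (injective⇒∈-permutations f w w-injective)))
    where
    a≢t : ∀ i → a ≢ lookup t i
    a≢t i eq with inj F.zero (F.suc i) eq
    ... | ()
    w : Vec (Fin f) f
    w = tabulate (λ i → punchOut (a≢t i))
    lookup-w : ∀ i → lookup w i ≡ punchOut (a≢t i)
    lookup-w = lookup∘tabulate (λ i → punchOut (a≢t i))
    insertAt-w≡ : insertAt a w ≡ a ∷ t
    insertAt-w≡ = cong (a ∷_) (lookup-extensionality _ _ λ i →
      trans (lookup-map i (punchIn a) w) (trans (cong (punchIn a) (lookup-w i)) (punchIn-punchOut (a≢t i))))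
    w-injective : Injectiveᵛ w
    w-injective i j eq = suc-injectiveᶠ (inj (F.suc i) (F.suc j)
      (punchOut-injective (a≢t i) (a≢t j) (trans (sym (lookup-w i)) (trans eq (lookup-w j)))))

  Unique-permutations : ∀ f → Unique (permutations f)
  Unique-permutations zero = [] ∷ []
  Unique-permutations (suc f) =
    Unique-concatMap (λ a → map (insertAt a) (permutations f)) (allFin⁺ (suc f))
      (λ _ → map⁺ insertAt-tail-injective (Unique-permutations f))
      (λ _ _ → same-head)
    where
    insertAt-tail-injective : ∀ {a} {x y : Vec (Fin f) f} → insertAt a x ≡ insertAt a y → x ≡ y
    insertAt-tail-injective {a} {x} {y} eq = lookup-extensionality x y λ i → punchIn-injective a _ _
      (trans (sym (lookup-map i (punchIn a) x)) (trans (cong (λ v → lookup v (F.suc i)) eq) (lookup-map i (punchIn a) y)))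
    same-head : ∀ {a b z} → z ∈ map (insertAt a) (permutations f) → z ∈ map (insertAt b) (permutations f) → a ≡ b
    same-head {a} {b} za zb with ∈-map⁻ (insertAt a) za | ∈-map⁻ (insertAt b) zb
    ... | _ , _ , refl | _ , _ , eq = cong (λ v → lookup v F.zero) eq

open Subsets
open Permutations

module Codes where

  -- A partition avoiding 12/34 is coded by its support S (the union of its non-singleton blocks)
  -- and, listing S increasingly: f block minima, then d elements of the block of the i-th minimum,
  -- then f block maxima, the q-th of which lies in the block of the (τ q)-th minimum.
  record Code (n : ℕ) : Set where
    constructor mk
    field
      f d : ℕ
      S : Vec Bool n
      τ : Vec (Fin f) f
      i : ℕ

  mk-τ-injective : ∀ {n f d d′ S S′ i i′} {τ τ′ : Vec (Fin f) f} → mk {n} f d S τ i ≡ mk f d′ S′ τ′ i′ → τ ≡ τ′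
  mk-τ-injective refl = refl

  -- Elements outside the support are singletons; a block is labelled by the rank in S of its minimum.
  data Label : Set where
    singleton : ℕ → Label
    block : ℕ → Label

  singleton-injective : ∀ {a b} → singleton a ≡ singleton b → a ≡ b
  singleton-injective refl = refl

  block-injective : ∀ {a b} → block a ≡ block b → a ≡ b
  block-injective refl = refl

  _≟ᴸ_ : (a b : Label) → Dec (a ≡ b)
  singleton a ≟ᴸ singleton b with a ≟ b
  ... | yes refl = yes refl
  ... | no a≢b = no (λ eq → a≢b (singleton-injective eq))
  singleton a ≟ᴸ block b = no (λ ())
  block a ≟ᴸ singleton b = no (λ ())
  block a ≟ᴸ block b with a ≟ b
  ... | yes refl = yes refl
  ... | no a≢b = no (λ eq → a≢b (block-injective eq))

  -- junk value 0 out of range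
  lookupℕ : ∀ {f} → Vec (Fin f) f → ℕ → ℕ
  lookupℕ {f} τ q with q <? f
  ... | yes q<f = toℕ (lookup τ (fromℕ< q<f))
  ... | no _ = 0

  lookupℕ-< : ∀ {f} (τ : Vec (Fin f) f) q (q<f : q < f) → lookupℕ τ q ≡ toℕ (lookup τ (fromℕ< q<f))
  lookupℕ-< {f} τ q q<f with q <? f
  ... | yes q<f′ = cong (λ p → toℕ (lookup τ (fromℕ< p))) (<-irrelevant q<f′ q<f)
  ... | no q≮f = ⊥-elim (q≮f q<f)

  lookupℕ-toℕ : ∀ {f} (τ : Vec (Fin f) f) q → lookupℕ τ (toℕ q) ≡ toℕ (lookup τ q)
  lookupℕ-toℕ τ q = trans (lookupℕ-< τ (toℕ q) (toℕ<n q)) (cong (λ j → toℕ (lookup τ j)) (fromℕ<-toℕ q (toℕ<n q)))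

  lookupℕ-injective : ∀ {f} (τ : Vec (Fin f) f) → Injectiveᵛ τ →
    ∀ q q′ → q < f → q′ < f → lookupℕ τ q ≡ lookupℕ τ q′ → q ≡ q′
  lookupℕ-injective τ inj q q′ q<f q′<f eq rewrite lookupℕ-< τ q q<f | lookupℕ-< τ q′ q′<f =
    trans (sym (toℕ-fromℕ< q<f)) (trans (cong toℕ (inj _ _ (toℕ-injective eq))) (toℕ-fromℕ< q′<f))

  lookupℕ< : ∀ {f} (τ : Vec (Fin f) f) q → q < f → lookupℕ τ q < f
  lookupℕ< τ q q<f rewrite lookupℕ-< τ q q<f = toℕ<n _

  blockOfRank : (f d : ℕ) → Vec (Fin f) f → ℕ → ℕ → ℕ
  blockOfRank f d τ i r with r <? f | r <? f + d
  ... | yes _ | _ = r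
  ... | no _ | yes _ = i
  ... | no _ | no _ = lookupℕ τ (r ∸ (f + d))

  blockOfRank-opener : ∀ f d τ i r → r < f → blockOfRank f d τ i r ≡ r
  blockOfRank-opener f d τ i r r<f with r <? f
  ... | yes _ = refl
  ... | no r≮f = ⊥-elim (r≮f r<f)

  blockOfRank-middle : ∀ f d τ i r → f ≤ r → r < f + d → blockOfRank f d τ i r ≡ i
  blockOfRank-middle f d τ i r f≤r r<f+d with r <? f | r <? f + d
  ... | yes r<f | _ = ⊥-elim (<⇒≱ r<f f≤r)
  ... | no _ | yes _ = refl
  ... | no _ | no r≮f+d = ⊥-elim (r≮f+d r<f+d)

  middle⇒0<d : ∀ {f d r} → f ≤ r → r < f + d → 0 < d
  middle⇒0<d {f} {zero} f≤r r<f+0 = ⊥-elim (<⇒≱ r<f+0 (subst (_≤ _) (sym (+-identityʳ f)) f≤r))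
  middle⇒0<d {d = suc _} _ _ = s≤s z≤n

  blockOfRank-closer : ∀ f d τ i r → f + d ≤ r → blockOfRank f d τ i r ≡ lookupℕ τ (r ∸ (f + d))
  blockOfRank-closer f d τ i r f+d≤r with r <? f | r <? f + d
  ... | yes r<f | _ = ⊥-elim (<⇒≱ r<f (≤-trans (m≤m+n f d) f+d≤r))
  ... | no _ | yes r<f+d = ⊥-elim (<⇒≱ r<f+d f+d≤r)
  ... | no _ | no _ = refl

  blockOfRank-closerAt : ∀ f d τ i q → blockOfRank f d τ i (f + d + toℕ q) ≡ toℕ (lookup τ q)
  blockOfRank-closerAt f d τ i q = begin
    blockOfRank f d τ i (f + d + toℕ q)  ≡⟨ blockOfRank-closer f d τ i _ (m≤m+n (f + d) (toℕ q)) ⟩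
    lookupℕ τ (f + d + toℕ q ∸ (f + d))  ≡⟨ cong (lookupℕ τ) (m+n∸m≡n (f + d) (toℕ q)) ⟩
    lookupℕ τ (toℕ q)                    ≡⟨ lookupℕ-toℕ τ q ⟩
    toℕ (lookup τ q)                     ∎
    where open ≡-Reasoning

  openerRank<2f+d : ∀ f d {r} → r < f → r < f + f + d
  openerRank<2f+d f d r<f = ≤-trans r<f (≤-trans (m≤m+n f f) (m≤m+n (f + f) d))

  closerRank<2f+d : ∀ f d {q} → q < f → f + d + q < f + f + d
  closerRank<2f+d f d {q} q<f = subst (f + d + q <_) (trans (+-assoc f d f) (trans (cong (f +_) (+-comm d f)) (sym (+-assoc f f d))))
    (+-monoʳ-< (f + d) q<f)

  label : ∀ {n} → Code n → ℕ → Label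
  label (mk f d S τ i) x = if member S x then block (blockOfRank f d τ i (rank S x)) else singleton x

  decode : ∀ {n} → Code n → RelMat n
  decode c = tabulate (λ x → tabulate (λ y → ⌊ label c (toℕ x) ≟ᴸ label c (toℕ y) ⌋))

  decode-lookup : ∀ {n} (c : Code n) x y → lookup (lookup (decode c) x) y ≡ ⌊ label c (toℕ x) ≟ᴸ label c (toℕ y) ⌋
  decode-lookup c x y = trans (cong (λ row → lookup row y) (lookup∘tabulate _ x)) (lookup∘tabulate _ y)

  ∼-decode⇒label≡ : ∀ {n} (c : Code n) x y → x ∼[ decode c ] y → label c (toℕ x) ≡ label c (toℕ y)
  ∼-decode⇒label≡ c x y x∼y = toWitness (subst T (decode-lookup c x y) x∼y)

  label≡⇒∼-decode : ∀ {n} (c : Code n) x y → label c (toℕ x) ≡ label c (toℕ y) → x ∼[ decode c ] y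
  label≡⇒∼-decode c x y eq = subst T (sym (decode-lookup c x y)) (fromWitness eq)

  decode-isSetPartition : ∀ {n} (c : Code n) → IsSetPartition (decode c)
  decode-isSetPartition c =
    (λ x → label≡⇒∼-decode c x x refl) ,
    (λ x y x∼y → label≡⇒∼-decode c y x (sym (∼-decode⇒label≡ c x y x∼y))) ,
    (λ x y z x∼y y∼z → label≡⇒∼-decode c x z (trans (∼-decode⇒label≡ c x y x∼y) (∼-decode⇒label≡ c y z y∼z)))

  module _ {n} (c : Code n) where
    open Code c

    label-∈ : ∀ x → member S x ≡ true → label c x ≡ block (blockOfRank f d τ i (rank S x))
    label-∈ x x∈S rewrite x∈S = refl

    label-∉ : ∀ x → member S x ≡ false → label c x ≡ singleton x
    label-∉ x x∉S rewrite x∉S = refl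

    label≡⇒∈ : ∀ {x y} → x ≢ y → label c x ≡ label c y → member S x ≡ true
    label≡⇒∈ {x} {y} x≢y eq with member S x | member S y
    ... | true | _ = refl
    ... | false | false = ⊥-elim (x≢y (singleton-injective eq))

  record Valid {n} (c : Code n) : Set where
    open Code c
    field
      weight-S : weight S ≡ f + f + d
      τ-injective : Injectiveᵛ τ
      τ-surjective : Surjectiveᵛ τ
      i-unused : d ≡ 0 → i ≡ 0
      i<f : 0 < d → i < f

open Codes

module ValidCode {n} {c : Code n} (valid : Valid c) where
  open Code c
  open Valid valid

  rank<2f+d : ∀ x → member S x ≡ true → rank S x < f + f + d
  rank<2f+d x x∈S = subst (rank S x <_) weight-S (rank<weight S x x∈S)

  closerIndex< : ∀ x → member S x ≡ true → f + d ≤ rank S x → rank S x ∸ (f + d) < f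
  closerIndex< x x∈S f+d≤r = +-cancelʳ-< (f + d) _ _ (begin-strict
    rank S x ∸ (f + d) + (f + d) ≡⟨ m∸n+n≡m f+d≤r ⟩
    rank S x                     <⟨ rank<2f+d x x∈S ⟩
    f + f + d                    ≡⟨ +-assoc f f d ⟩
    f + (f + d)                  ∎)
    where open ≤-Reasoning

  opener-minimal : ∀ x y → member S x ≡ true → rank S x < f → y < x → label c y ≢ label c x
  opener-minimal x y x∈S rx<f y<x eq = <-irrefl ry≡rx ry<rx
    where
    y∈S = label≡⇒∈ c (<⇒≢ y<x) eq
    ry<rx = count-strict (member S) y∈S y<x
    ry≡rx : rank S y ≡ rank S x
    ry≡rx = begin
      rank S y                          ≡⟨ blockOfRank-opener f d τ i _ (<-trans ry<rx rx<f) ⟨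
      blockOfRank f d τ i (rank S y)    ≡⟨ block-injective (trans (sym (label-∈ c y y∈S)) (trans eq (label-∈ c x x∈S))) ⟩
      blockOfRank f d τ i (rank S x)    ≡⟨ blockOfRank-opener f d τ i _ rx<f ⟩
      rank S x                          ∎
      where open ≡-Reasoning

  closer-maximal : ∀ x y → member S x ≡ true → f + d ≤ rank S x → x < y → label c y ≢ label c x
  closer-maximal x y x∈S f+d≤rx x<y eq = <-irrefl (sym ry≡rx) rx<ry
    where
    y∈S = label≡⇒∈ c (λ y≡x → <⇒≢ x<y (sym y≡x)) eq
    rx<ry = count-strict (member S) x∈S x<y
    f+d≤ry = ≤-trans f+d≤rx (<⇒≤ rx<ry)
    index≡ : rank S y ∸ (f + d) ≡ rank S x ∸ (f + d)
    index≡ = lookupℕ-injective τ τ-injective _ _ (closerIndex< y y∈S f+d≤ry) (closerIndex< x x∈S f+d≤rx) (begin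
      lookupℕ τ (rank S y ∸ (f + d))    ≡⟨ blockOfRank-closer f d τ i _ f+d≤ry ⟨
      blockOfRank f d τ i (rank S y)    ≡⟨ block-injective (trans (sym (label-∈ c y y∈S)) (trans eq (label-∈ c x x∈S))) ⟩
      blockOfRank f d τ i (rank S x)    ≡⟨ blockOfRank-closer f d τ i _ f+d≤rx ⟩
      lookupℕ τ (rank S x ∸ (f + d))    ∎)
      where open ≡-Reasoning
    ry≡rx : rank S y ≡ rank S x
    ry≡rx = trans (sym (m∸n+n≡m f+d≤ry)) (trans (cong (_+ (f + d)) index≡) (m∸n+n≡m f+d≤rx))

  module _ r (r<2f+d : r < f + f + d) where

    private
      selected = count-select (member S) n r (subst (r <_) (sym (trans (count-member S) weight-S)) r<2f+d)

    atRank : ℕ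
    atRank = proj₁ selected

    atRank<n : atRank < n
    atRank<n = proj₁ (proj₂ selected)

    atRank∈S : member S atRank ≡ true
    atRank∈S = proj₁ (proj₂ (proj₂ selected))

    rank-atRank : rank S atRank ≡ r
    rank-atRank = proj₂ (proj₂ (proj₂ selected))

    label-atRank : label c atRank ≡ block (blockOfRank f d τ i r)
    label-atRank = trans (label-∈ c atRank atRank∈S) (cong (block ∘ blockOfRank f d τ i) rank-atRank)

  blockOfRank<f : ∀ r → r < f + f + d → blockOfRank f d τ i r < f
  blockOfRank<f r r<2f+d with r <? f | r <? f + d
  ... | yes r<f | _ = r<f
  ... | no r≮f | yes r<f+d = i<f (middle⇒0<d (≮⇒≥ r≮f) r<f+d)
  ... | no _ | no r≮f+d = lookupℕ< τ _ (+-cancelʳ-< (f + d) _ _ (begin-strict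
    r ∸ (f + d) + (f + d)  ≡⟨ m∸n+n≡m (≮⇒≥ r≮f+d) ⟩
    r                      <⟨ r<2f+d ⟩
    f + f + d              ≡⟨ +-assoc f f d ⟩
    f + (f + d)            ∎))
    where open ≤-Reasoning

  rank<rank⇒< : ∀ {x y} → member S y ≡ true → rank S x < rank S y → x < y
  rank<rank⇒< {x} {y} y∈S rx<ry with <-cmp x y
  ... | tri< x<y _ _ = x<y
  ... | tri≈ _ refl _ = ⊥-elim (<-irrefl refl rx<ry)
  ... | tri> _ _ y<x = ⊥-elim (<-asym rx<ry (count-strict (member S) y∈S y<x))

  smaller-partner : ∀ x → member S x ≡ true → f ≤ rank S x → Σ ℕ λ y → y < x × label c y ≡ label c x
  smaller-partner x x∈S f≤r = atRank b b<2f+d , rank<rank⇒< x∈S (subst (_< rank S x) (sym (rank-atRank b b<2f+d)) (<-≤-trans b<f f≤r)) , (begin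
    label c (atRank b b<2f+d)         ≡⟨ label-atRank b b<2f+d ⟩
    block (blockOfRank f d τ i b)     ≡⟨ cong block (blockOfRank-opener f d τ i b b<f) ⟩
    block b                           ≡⟨ label-∈ c x x∈S ⟨
    label c x                         ∎)
    where
    open ≡-Reasoning
    b = blockOfRank f d τ i (rank S x)
    b<f = blockOfRank<f (rank S x) (rank<2f+d x x∈S)
    b<2f+d = openerRank<2f+d f d b<f

  -- the maximum of the block is found through the surjectivity of τ
  larger-partner : ∀ x → member S x ≡ true → rank S x < f → Σ ℕ λ y → x < y × y < n × label c y ≡ label c x
  larger-partner x x∈S r<f with τ-surjective (fromℕ< r<f)
  ... | q , τq≡r = atRank r′ r′<2f+d , x<y , atRank<n r′ r′<2f+d , (begin
    label c (atRank r′ r′<2f+d)             ≡⟨ label-atRank r′ r′<2f+d ⟩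
    block (blockOfRank f d τ i r′)          ≡⟨ cong block (blockOfRank-closerAt f d τ i q) ⟩
    block (toℕ (lookup τ q))                ≡⟨ cong block (trans (cong toℕ τq≡r) (toℕ-fromℕ< r<f)) ⟩
    block (rank S x)                        ≡⟨ cong block (blockOfRank-opener f d τ i _ r<f) ⟨
    block (blockOfRank f d τ i (rank S x))  ≡⟨ label-∈ c x x∈S ⟨
    label c x                               ∎)
    where
    open ≡-Reasoning
    r′ = f + d + toℕ q
    r′<2f+d = closerRank<2f+d f d (toℕ<n q)
    x<y : x < atRank r′ r′<2f+d
    x<y = rank<rank⇒< (atRank∈S r′ r′<2f+d)
            (subst (rank S x <_) (sym (rank-atRank r′ r′<2f+d)) (<-≤-trans r<f (≤-trans (m≤m+n f d) (m≤m+n (f + d) (toℕ q)))))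

  partner : ∀ x → member S x ≡ true → Σ ℕ λ y → y ≢ x × y < n × label c y ≡ label c x
  partner x x∈S = by-rank (rank S x <? f)
    where
    by-rank : Dec (rank S x < f) → Σ ℕ λ y → y ≢ x × y < n × label c y ≡ label c x
    by-rank (yes r<f) with larger-partner x x∈S r<f
    ... | y , x<y , y<n , same = y , (λ y≡x → <⇒≢ x<y (sym y≡x)) , y<n , same
    by-rank (no r≮f) with smaller-partner x x∈S (≮⇒≥ r≮f)
    ... | y , y<x , same = y , <⇒≢ y<x , <-trans y<x (member⇒< S x x∈S) , same

  -- In a pattern a < b < c′ < d′ with a, b and c′, d′ in common blocks, b is not a minimum and
  -- c′ is not a maximum, so both lie in the middle segment, i.e. in block i.
  no-12/34-labels : ∀ a b c′ d′ → a < b → b < c′ → c′ < d′ →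
    label c a ≡ label c b → label c c′ ≡ label c d′ → label c a ≡ label c c′
  no-12/34-labels a b c′ d′ a<b b<c′ c′<d′ a~b c′~d′ = begin
    label c a                         ≡⟨ a~b ⟩
    label c b                         ≡⟨ label-∈ c b b∈S ⟩
    block (blockOfRank f d τ i rb)    ≡⟨ cong block (blockOfRank-middle f d τ i rb f≤rb (<-trans rb<rc rc<f+d)) ⟩
    block i                           ≡⟨ cong block (blockOfRank-middle f d τ i rc (<⇒≤ (≤-<-trans f≤rb rb<rc)) rc<f+d) ⟨
    block (blockOfRank f d τ i rc)    ≡⟨ label-∈ c c′ c′∈S ⟨
    label c c′                        ∎
    where
    open ≡-Reasoning
    b∈S = label≡⇒∈ c (λ b≡a → <⇒≢ a<b (sym b≡a)) (sym a~b)
    c′∈S = label≡⇒∈ c (<⇒≢ c′<d′) c′~d′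
    rb = rank S b
    rc = rank S c′
    rb<rc = count-strict (member S) b∈S b<c′
    f≤rb : f ≤ rb
    f≤rb = ≮⇒≥ (λ rb<f → opener-minimal b a b∈S rb<f a<b a~b)
    rc<f+d : rc < f + d
    rc<f+d = ≰⇒> (λ f+d≤rc → closer-maximal c′ d′ c′∈S f+d≤rc c′<d′ (sym c′~d′))

  decode-avoids : Avoids (decode c) p12/34
  decode-avoids (g , increasing , g-pattern) =
    0≢1 (Equivalence.to (g-pattern 0F 2F) (label≡⇒∼-decode c (g 0F) (g 2F)
      (no-12/34-labels _ _ _ _ (increasing 0F 1F (s≤s z≤n)) (increasing 1F 2F (s≤s (s≤s z≤n))) (increasing 2F 3F (s≤s (s≤s (s≤s z≤n))))
        (∼-decode⇒label≡ c (g 0F) (g 1F) (Equivalence.from (g-pattern 0F 1F) refl))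
        (∼-decode⇒label≡ c (g 2F) (g 3F) (Equivalence.from (g-pattern 2F 3F) refl)))))
    where
    0F 1F 2F 3F : Fin 4
    0F = F.zero
    1F = F.suc F.zero
    2F = F.suc (F.suc F.zero)
    3F = F.suc (F.suc (F.suc F.zero))
    0≢1 : 0 ≢ 1
    0≢1 ()

module Enumeration where

  pairCodes : ∀ n k → List (Code n)
  pairCodes n k = concatMap (λ S → map (λ τ → mk k 0 S τ 0) (permutations k)) (subsets n (2 * k))

  -- k + 1 blocks, one of size l ≥ 3 and the others of size two
  largeBlockCode : ∀ {n} k l → Vec Bool n → Vec (Fin (suc k)) (suc k) → Fin (suc k) → Code n
  largeBlockCode k l S τ j = mk (suc k) (l ∸ 2) S τ (toℕ j)

  largeBlockCodesWith : ∀ {n} k l → Vec Bool n → Vec (Fin (suc k)) (suc k) → List (Code n)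
  largeBlockCodesWith k l S τ = map (largeBlockCode k l S τ) (allFin (suc k))

  largeBlockCodes : ∀ n k l → List (Code n)
  largeBlockCodes n k l = concatMap (λ S → concatMap (largeBlockCodesWith k l S) (permutations (suc k))) (subsets n (2 * k + l))

  largeBlockPart : ∀ n k → List (Code n)
  largeBlockPart n k = concatMap (λ l′ → largeBlockCodes n k (3 + l′)) (upTo (suc (n ∸ 2 * k) ∸ 3))

  codesAt : ∀ n k → List (Code n)
  codesAt n k = pairCodes n k ++ largeBlockPart n k

  codes : ∀ n → List (Code n)
  codes n = concatMap (codesAt n) (upTo (suc (n / 2)))

  length-pairCodes : ∀ n k → length (pairCodes n k) ≡ (k !) * (n C (2 * k))
  length-pairCodes n k = begin
    length (pairCodes n k)           ≡⟨ length-concatMap-const _ (subsets n (2 * k)) (k !)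
                                          (λ _ → trans (length-map _ (permutations k)) (length-permutations k)) ⟩
    length (subsets n (2 * k)) * k ! ≡⟨ cong (_* k !) (length-subsets n (2 * k)) ⟩
    (n C (2 * k)) * k !              ≡⟨ *-comm (n C (2 * k)) (k !) ⟩
    (k !) * (n C (2 * k))            ∎
    where open ≡-Reasoning

  length-largeBlockCodes : ∀ n k l → length (largeBlockCodes n k l) ≡ (n C (2 * k + l)) * (k !) * ((k + 1) ^ 2)
  length-largeBlockCodes n k l = begin
    length (largeBlockCodes n k l)
      ≡⟨ length-concatMap-const _ (subsets n (2 * k + l)) (suc k ! * suc k) (λ _ →
           trans (length-concatMap-const _ (permutations (suc k)) (suc k) (λ _ →
                   trans (length-map _ (allFin (suc k))) (length-tabulate {n = suc k} (λ j → j))))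
                 (cong (_* suc k) (length-permutations (suc k)))) ⟩
    length (subsets n (2 * k + l)) * (suc k ! * suc k)
      ≡⟨ cong (_* (suc k ! * suc k)) (length-subsets n (2 * k + l)) ⟩
    (n C (2 * k + l)) * (suc k ! * suc k)
      ≡⟨ factorial-identity (n C (2 * k + l)) (k !) k ⟩
    (n C (2 * k + l)) * (k !) * ((k + 1) ^ 2) ∎
    where
    open ≡-Reasoning
    factorial-identity : ∀ c f k → c * ((1 + k) * f * (1 + k)) ≡ c * f * ((k + 1) * ((k + 1) * 1))
    factorial-identity = solve-∀

  length-codes : ∀ n → length (codes n) ≡
    sumFromTo 0 (n / 2) (λ k →
      (k !) * (n C (2 * k))
      + sumFromTo 3 (n ∸ 2 * k) (λ l → (n C (2 * k + l)) * (k !) * ((k + 1) ^ 2)))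
  length-codes n =
    trans (length-concatMap (codesAt n) (upTo (suc (n / 2)))) (cong sum (map-cong length-codesAt (upTo (suc (n / 2)))))
    where
    length-codesAt : ∀ k → length (codesAt n k) ≡
      (k !) * (n C (2 * k)) + sumFromTo 3 (n ∸ 2 * k) (λ l → (n C (2 * k + l)) * (k !) * ((k + 1) ^ 2))
    length-codesAt k =
      trans (length-++ (pairCodes n k))
        (cong₂ _+_ (length-pairCodes n k)
          (trans (length-concatMap (λ l′ → largeBlockCodes n k (3 + l′)) (upTo (suc (n ∸ 2 * k) ∸ 3)))
            (cong sum (map-cong (λ l′ → length-largeBlockCodes n k (3 + l′)) (upTo (suc (n ∸ 2 * k) ∸ 3))))))

  ∈-pairCodes⁻ : ∀ {n k z} → z ∈ pairCodes n k →
    Σ (Vec Bool n) λ S → Σ (Vec (Fin k) k) λ τ → S ∈ subsets n (2 * k) × τ ∈ permutations k × z ≡ mk k 0 S τ 0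
  ∈-pairCodes⁻ {n} {k} z∈ with find (∈-concatMap⁻ (λ S → map (λ τ → mk k 0 S τ 0) (permutations k)) {xs = subsets n (2 * k)} z∈)
  ... | S , S∈ , z∈S with ∈-map⁻ (λ τ → mk k 0 S τ 0) z∈S
  ...   | τ , τ∈ , z≡ = S , τ , S∈ , τ∈ , z≡

  ∈-largeBlockCodes⁻ : ∀ {n k l z} → z ∈ largeBlockCodes n k l →
    Σ (Vec Bool n) λ S → Σ (Vec (Fin (suc k)) (suc k)) λ τ → Σ (Fin (suc k)) λ j →
      S ∈ subsets n (2 * k + l) × τ ∈ permutations (suc k) × z ≡ mk (suc k) (l ∸ 2) S τ (toℕ j)
  ∈-largeBlockCodes⁻ {n} {k} {l} z∈
    with find (∈-concatMap⁻ (λ S → concatMap (largeBlockCodesWith k l S) (permutations (suc k))) {xs = subsets n (2 * k + l)} z∈)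
  ... | S , S∈ , z∈S with find (∈-concatMap⁻ (largeBlockCodesWith k l S) {xs = permutations (suc k)} z∈S)
  ...   | τ , τ∈ , z∈τ with ∈-map⁻ (largeBlockCode k l S τ) z∈τ
  ...     | j , _ , z≡ = S , τ , j , S∈ , τ∈ , z≡

  ∈-largeBlockPart⁻ : ∀ {n k z} → z ∈ largeBlockPart n k → Σ ℕ λ l′ → z ∈ largeBlockCodes n k (3 + l′)
  ∈-largeBlockPart⁻ {n} {k} z∈ with find (∈-concatMap⁻ (λ l′ → largeBlockCodes n k (3 + l′)) {xs = upTo (suc (n ∸ 2 * k) ∸ 3)} z∈)
  ... | l′ , _ , z∈l′ = l′ , z∈l′

  ∈-codesAt⁻ : ∀ {n k z} → z ∈ codesAt n k → z ∈ pairCodes n k ⊎ Σ ℕ λ l′ → z ∈ largeBlockCodes n k (3 + l′)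
  ∈-codesAt⁻ {n} {k} z∈ with ∈-++⁻ (pairCodes n k) z∈
  ... | inj₁ z∈pairs = inj₁ z∈pairs
  ... | inj₂ z∈large = inj₂ (∈-largeBlockPart⁻ {n} {k} z∈large)

  ∈-codes⇒valid : ∀ {n} z → z ∈ codes n → Valid z
  ∈-codes⇒valid {n} z z∈ with find (∈-concatMap⁻ (codesAt n) {xs = upTo (suc (n / 2))} z∈)
  ... | k , _ , z∈k with ∈-codesAt⁻ {n} {k} z∈k
  ...   | inj₁ z∈pairs with ∈-pairCodes⁻ {n} {k} z∈pairs
  ...     | S , τ , S∈ , τ∈ , refl = record
    { weight-S = trans (∈-subsets⁻ _ _ S S∈) (2*k≡k+k+0 k)
    ; τ-injective = ∈-permutations⇒injective k τ τ∈
    ; τ-surjective = ∈-permutations⇒surjective k τ τ∈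
    ; i-unused = λ _ → refl
    ; i<f = λ () }
    where
    2*k≡k+k+0 : ∀ k → 2 * k ≡ k + k + 0
    2*k≡k+k+0 = solve-∀
  ∈-codes⇒valid {n} z z∈ | k , _ , z∈k | inj₂ (l′ , z∈large) with ∈-largeBlockCodes⁻ {n} {k} {3 + l′} z∈large
  ...     | S , τ , j , S∈ , τ∈ , refl = record
    { weight-S = trans (∈-subsets⁻ _ _ S S∈) (2*k+[3+l]≡1+k+1+k+1+l k l′)
    ; τ-injective = ∈-permutations⇒injective (suc k) τ τ∈
    ; τ-surjective = ∈-permutations⇒surjective (suc k) τ τ∈
    ; i-unused = λ ()
    ; i<f = λ _ → toℕ<n j }
    where
    2*k+[3+l]≡1+k+1+k+1+l : ∀ k l → 2 * k + (3 + l) ≡ suc k + suc k + suc l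
    2*k+[3+l]≡1+k+1+k+1+l = solve-∀

  -- the summation index k of the theorem from which a code stems
  outerIndex : ∀ {n} → Code n → ℕ
  outerIndex (mk f zero S τ i) = f
  outerIndex (mk f (suc d) S τ i) = pred f

  Unique-pairCodes : ∀ n k → Unique (pairCodes n k)
  Unique-pairCodes n k =
    Unique-concatMap-keyed _ Code.S (Unique-subsets n (2 * k)) (λ _ → map⁺ mk-τ-injective (Unique-permutations k)) S-spec
    where
    S-spec : ∀ {S z} → S ∈ subsets n (2 * k) → z ∈ map (λ τ → mk k 0 S τ 0) (permutations k) → Code.S z ≡ S
    S-spec {S} _ z∈ with ∈-map⁻ (λ τ → mk k 0 S τ 0) z∈
    ... | _ , _ , refl = refl

  Unique-largeBlockCodes : ∀ n k l → Unique (largeBlockCodes n k l)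
  Unique-largeBlockCodes n k l =
    Unique-concatMap-keyed _ Code.S (Unique-subsets n (2 * k + l))
      (λ {S} _ → Unique-concatMap _ (Unique-permutations (suc k))
                   (λ _ → map⁺ (λ eq → toℕ-injective (cong Code.i eq)) (allFin⁺ (suc k))) (λ _ _ → same-τ))
      S-spec
    where
    same-τ : ∀ {S τ τ′ z} → z ∈ largeBlockCodesWith k l S τ → z ∈ largeBlockCodesWith k l S τ′ → τ ≡ τ′
    same-τ {S} {τ} {τ′} z∈ z∈′ with ∈-map⁻ (largeBlockCode k l S τ) z∈ | ∈-map⁻ (largeBlockCode k l S τ′) z∈′
    ... | _ , _ , refl | _ , _ , eq = mk-τ-injective eq
    S-spec : ∀ {S z} → S ∈ subsets n (2 * k + l) → z ∈ concatMap (largeBlockCodesWith k l S) (permutations (suc k)) → Code.S z ≡ S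
    S-spec {S} _ z∈ with find (∈-concatMap⁻ (largeBlockCodesWith k l S) {xs = permutations (suc k)} z∈)
    ... | τ , _ , z∈τ with ∈-map⁻ (largeBlockCode k l S τ) z∈τ
    ...   | _ , _ , refl = refl

  Unique-codes : ∀ n → Unique (codes n)
  Unique-codes n = Unique-concatMap-keyed (codesAt n) outerIndex (upTo⁺ (suc (n / 2))) (λ {k} _ → Unique-codesAt k) outerIndex-spec
    where
    d-spec : ∀ {k l′ z} → z ∈ largeBlockCodes n k (3 + l′) → Code.d z ≡ suc l′
    d-spec {k} {l′} z∈ with ∈-largeBlockCodes⁻ {n} {k} {3 + l′} z∈
    ... | _ , _ , _ , _ , _ , refl = refl
    Unique-codesAt : ∀ k → Unique (codesAt n k)
    Unique-codesAt k =
      ++⁺ (Unique-pairCodes n k)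
          (Unique-concatMap-keyed _ (pred ∘ Code.d) (upTo⁺ (suc (n ∸ 2 * k) ∸ 3))
            (λ {l′} _ → Unique-largeBlockCodes n k (3 + l′)) (λ {l′} _ z∈ → cong pred (d-spec {k} {l′} z∈)))
          disjoint
      where
      disjoint : ∀ {z} → z ∈ pairCodes n k × z ∈ largeBlockPart n k → ⊥
      disjoint (z∈pairs , z∈large) with ∈-pairCodes⁻ {n} {k} z∈pairs | ∈-largeBlockPart⁻ {n} {k} z∈large
      ... | _ , _ , _ , _ , refl | l′ , z∈l′ with () ← d-spec {k} {l′} z∈l′
    outerIndex-spec : ∀ {k z} → k ∈ upTo (suc (n / 2)) → z ∈ codesAt n k → outerIndex z ≡ k
    outerIndex-spec {k} _ z∈ with ∈-codesAt⁻ {n} {k} z∈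
    ... | inj₁ z∈pairs with ∈-pairCodes⁻ {n} {k} z∈pairs
    ...   | _ , _ , _ , _ , refl = refl
    outerIndex-spec {k} _ z∈ | inj₂ (l′ , z∈large) with ∈-largeBlockCodes⁻ {n} {k} {3 + l′} z∈large
    ...   | _ , _ , _ , _ , _ , refl = refl

  private
    k<1+n/2 : ∀ k n → 2 * k ≤ n → k < suc (n / 2)
    k<1+n/2 k n 2k≤n = s≤s (begin
      k             ≡⟨ m*n/n≡m k 2 ⟨
      k * 2 / 2     ≤⟨ /-monoˡ-≤ 2 (subst (_≤ n) (*-comm 2 k) 2k≤n) ⟩
      n / 2         ∎)
      where open ≤-Reasoning

    l<1+n∸2k∸3 : ∀ k l n → 2 * k + (3 + l) ≤ n → l < suc (n ∸ 2 * k) ∸ 3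
    l<1+n∸2k∸3 k l n bound = m+n≤o⇒m≤o∸n (suc l) (s≤s (m+n≤o⇒m≤o∸n (l + 3) (subst (_≤ n) (shuffle k l) bound)))
      where
      shuffle : ∀ k l → 2 * k + (3 + l) ≡ l + 3 + 2 * k
      shuffle = solve-∀

  shape⇒∈-codes : ∀ {n} f d (S : Vec Bool n) (τ : Vec (Fin f) f) i → weight S ≡ f + f + d → Injectiveᵛ τ →
    (d ≡ 0 → i ≡ 0) → (0 < d → i < f) → mk f d S τ i ∈ codes n
  shape⇒∈-codes {n} f zero S τ i weight≡ τ-injective i-unused _ rewrite i-unused refl =
    ∈-concatMap-intro (codesAt n) (∈-upTo⁺ (k<1+n/2 f n (subst (_≤ n) size≡ (weight≤ S))))
      (∈-++⁺ˡ (∈-concatMap-intro _ (∈-subsets⁺ n (2 * f) S size≡)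
        (∈-map⁺ (λ τ → mk f 0 S τ 0) (injective⇒∈-permutations f τ τ-injective))))
    where
    size≡ : weight S ≡ 2 * f
    size≡ = trans weight≡ (f+f+0≡2*f f)
      where
      f+f+0≡2*f : ∀ f → f + f + 0 ≡ 2 * f
      f+f+0≡2*f = solve-∀
  shape⇒∈-codes zero (suc d) S τ i _ _ _ i<f with () ← i<f (s≤s z≤n)
  shape⇒∈-codes {n} (suc k) (suc l) S τ i weight≡ τ-injective _ i<f =
    subst (λ i → mk (suc k) (suc l) S τ i ∈ codes n) (toℕ-fromℕ< i<1+k)
      (∈-concatMap-intro (codesAt n) (∈-upTo⁺ (k<1+n/2 k n (≤-trans (m≤m+n (2 * k) (3 + l)) size≤n)))
        (∈-++⁺ʳ (pairCodes n k)
          (∈-concatMap-intro (λ l′ → largeBlockCodes n k (3 + l′)) (∈-upTo⁺ (l<1+n∸2k∸3 k l n size≤n))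
            (∈-concatMap-intro _ (∈-subsets⁺ n _ S size≡)
              (∈-concatMap-intro _ (injective⇒∈-permutations (suc k) τ τ-injective)
                (∈-map⁺ (largeBlockCode k (3 + l) S τ) (∈-allFin (fromℕ< i<1+k))))))))
    where
    i<1+k = i<f (s≤s z≤n)
    size≡ : weight S ≡ 2 * k + (3 + l)
    size≡ = trans weight≡ (shift k l)
      where
      shift : ∀ k l → suc k + suc k + suc l ≡ 2 * k + (3 + l)
      shift = solve-∀
    size≤n : 2 * k + (3 + l) ≤ n
    size≤n = subst (_≤ n) size≡ (weight≤ S)

open Enumeration

entry : ∀ {m n} → Vec (Vec Bool n) m → ℕ → ℕ → Bool
entry [] _ _ = false
entry (row ∷ M) zero y = member row y
entry (row ∷ M) (suc x) y = entry M x y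

entry-lookup : ∀ {m n} (M : Vec (Vec Bool n) m) i j → entry M (toℕ i) (toℕ j) ≡ lookup (lookup M i) j
entry-lookup (row ∷ M) F.zero j = member-lookup row j
entry-lookup (row ∷ M) (F.suc i) j = entry-lookup M i j

entry⇒< : ∀ {m n} (M : Vec (Vec Bool n) m) x y → entry M x y ≡ true → x < m × y < n
entry⇒< (row ∷ M) zero y x∼y = s≤s z≤n , member⇒< row y x∼y
entry⇒< (row ∷ M) (suc x) y x∼y with entry⇒< M x y x∼y
... | x<m , y<n = s≤s x<m , y<n

increasing-by-steps : ∀ (h : ℕ → ℕ) k → (∀ x → suc x < k → h x < h (suc x)) → ∀ x y → x < y → y < k → h x < h y
increasing-by-steps h k step x (suc y) x<1+y 1+y<k with m≤n⇒m<n∨m≡n (≤-pred x<1+y)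
... | inj₂ refl = step x 1+y<k
... | inj₁ x<y = <-trans (increasing-by-steps h k step x y x<y (<-trans (n<1+n y) 1+y<k)) (step y 1+y<k)

block-12/34≤1 : ∀ i → block-12/34 i ≤ 1
block-12/34≤1 F.zero = z≤n
block-12/34≤1 (F.suc F.zero) = z≤n
block-12/34≤1 (F.suc (F.suc F.zero)) = ≤-refl
block-12/34≤1 (F.suc (F.suc (F.suc F.zero))) = ≤-refl

bool-cases : ∀ (b : Bool) → b ≡ true ⊎ b ≡ false
bool-cases true = inj₁ refl
bool-cases false = inj₂ refl

true≢false : ∀ {b} → b ≡ true → b ≢ false
true≢false refl ()

module SameBlock {n} (M : RelMat n) (M-isPartition : IsSetPartition M) where

  _≈_ : ℕ → ℕ → Set
  x ≈ y = entry M x y ≡ true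

  ≈⇒<ˡ : ∀ {x y} → x ≈ y → x < n
  ≈⇒<ˡ {x} {y} x≈y = proj₁ (entry⇒< M x y x≈y)

  ≈⇒<ʳ : ∀ {x y} → x ≈ y → y < n
  ≈⇒<ʳ {x} {y} x≈y = proj₂ (entry⇒< M x y x≈y)

  ≈⇔∼ : ∀ {x y} (x<n : x < n) (y<n : y < n) → x ≈ y ⇔ (fromℕ< x<n ∼[ M ] fromℕ< y<n)
  ≈⇔∼ {x} {y} x<n y<n = mk⇔
    (λ x≈y → Equivalence.from T-≡ (trans (sym entry≡) x≈y))
    (λ x∼y → trans entry≡ (Equivalence.to T-≡ x∼y))
    where
    entry≡ : entry M x y ≡ lookup (lookup M (fromℕ< x<n)) (fromℕ< y<n)
    entry≡ = trans (cong₂ (entry M) (sym (toℕ-fromℕ< x<n)) (sym (toℕ-fromℕ< y<n))) (entry-lookup M _ _)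

  ≈-refl : ∀ {x} → x < n → x ≈ x
  ≈-refl x<n = Equivalence.from (≈⇔∼ x<n x<n) (proj₁ M-isPartition _)

  ≈-sym : ∀ {x y} → x ≈ y → y ≈ x
  ≈-sym x≈y = Equivalence.from (≈⇔∼ (≈⇒<ʳ x≈y) (≈⇒<ˡ x≈y))
    (proj₁ (proj₂ M-isPartition) _ _ (Equivalence.to (≈⇔∼ (≈⇒<ˡ x≈y) (≈⇒<ʳ x≈y)) x≈y))

  ≈-trans : ∀ {x y z} → x ≈ y → y ≈ z → x ≈ z
  ≈-trans x≈y y≈z = Equivalence.from (≈⇔∼ (≈⇒<ˡ x≈y) (≈⇒<ʳ y≈z))
    (proj₂ (proj₂ M-isPartition) _ _ _ (Equivalence.to (≈⇔∼ (≈⇒<ˡ x≈y) (≈⇒<ʳ x≈y)) x≈y)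
                                         (Equivalence.to (≈⇔∼ (≈⇒<ˡ y≈z) (≈⇒<ʳ y≈z)) y≈z))

  ≈-respects : ∀ {x x′ y y′} → x ≈ x′ → y ≈ y′ → x ≈ y ⇔ x′ ≈ y′
  ≈-respects x≈x′ y≈y′ = mk⇔ (λ x≈y → ≈-trans (≈-sym x≈x′) (≈-trans x≈y y≈y′))
                              (λ x′≈y′ → ≈-trans x≈x′ (≈-trans x′≈y′ (≈-sym y≈y′)))

  occurrence : ∀ {a b c d} → a < b → b < c → c < d → a ≈ b → c ≈ d → entry M b c ≡ false → Contains M p12/34
  occurrence {a} {b} {c} {d} a<b b<c c<d a≈b c≈d b≉c = g , g-increasing , g-pattern
    where
    position : ℕ → ℕ
    position 0 = a
    position 1 = b
    position 2 = c
    position _ = d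
    step : ∀ x → suc x < 4 → position x < position (suc x)
    step 0 _ = a<b
    step 1 _ = b<c
    step 2 _ = c<d
    step (suc (suc (suc _))) (s≤s (s≤s (s≤s (s≤s ()))))
    position<n : ∀ (i : Fin 4) → position (toℕ i) < n
    position<n i with toℕ i <? 3
    ... | yes i<3 = <-trans (increasing-by-steps position 4 step (toℕ i) 3 i<3 ≤-refl) (≈⇒<ʳ c≈d)
    ... | no i≮3 rewrite ≤-antisym (≤-pred (toℕ<n i)) (≮⇒≥ i≮3) = ≈⇒<ʳ c≈d
    g : Fin 4 → Fin n
    g i = fromℕ< (position<n i)
    g-increasing : StrictlyIncreasing g
    g-increasing i j i<j rewrite toℕ-fromℕ< (position<n i) | toℕ-fromℕ< (position<n j) =
      increasing-by-steps position 4 step (toℕ i) (toℕ j) i<j (toℕ<n j)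
    representative : ℕ → ℕ
    representative 0 = a
    representative _ = c
    ≈-representative : ∀ i → position (toℕ i) ≈ representative (block-12/34 i)
    ≈-representative F.zero = ≈-refl (<-trans a<b (<-trans b<c (≈⇒<ˡ c≈d)))
    ≈-representative (F.suc F.zero) = ≈-sym a≈b
    ≈-representative (F.suc (F.suc F.zero)) = ≈-refl (≈⇒<ˡ c≈d)
    ≈-representative (F.suc (F.suc (F.suc F.zero))) = ≈-sym c≈d
    a≉c : ¬ (a ≈ c)
    a≉c a≈c = true≢false (≈-trans (≈-sym a≈b) a≈c) b≉c
    representatives : ∀ i j → representative (block-12/34 i) ≈ representative (block-12/34 j) ⇔ p12/34 i j
    representatives i j with block-12/34 i | block-12/34 j | block-12/34≤1 i | block-12/34≤1 j
    ... | 0 | 0 | _ | _ = mk⇔ (λ _ → refl) (λ _ → ≈-representative F.zero)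
    ... | 0 | suc _ | _ | _ = mk⇔ (λ a≈c → ⊥-elim (a≉c a≈c)) (λ ())
    ... | suc _ | 0 | _ | _ = mk⇔ (λ c≈a → ⊥-elim (a≉c (≈-sym c≈a))) (λ ())
    ... | 1 | 1 | _ | _ = mk⇔ (λ _ → refl) (λ _ → ≈-refl (≈⇒<ˡ c≈d))
    ... | 1 | suc (suc _) | _ | s≤s ()
    ... | suc (suc _) | _ | s≤s () | _
    g-pattern : ∀ i j → (g i ∼[ M ] g j) ⇔ p12/34 i j
    g-pattern i j =
      ⇔-trans (⇔-sym (≈⇔∼ (position<n i) (position<n j)))
        (⇔-trans (≈-respects (≈-representative i) (≈-representative j)) (representatives i j))

module Structure {n} (M : RelMat n) (M-isPartition : IsSetPartition M) (avoids : Avoids M p12/34) where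
  open SameBlock M M-isPartition public

  mates-between : ∀ {a b c d} → a < b → b < c → c < d → a ≈ b → c ≈ d → b ≈ c
  mates-between {b = b} {c} a<b b<c c<d a≈b c≈d with entry M b c in b∼c
  ... | true = refl
  ... | false = ⊥-elim (avoids (occurrence a<b b<c c<d a≈b c≈d b∼c))

  hasSmaller : ℕ → Bool
  hasSmaller x = anyBelow (λ y → entry M y x) x

  hasLarger : ℕ → Bool
  hasLarger x = anyBelow (λ y → (x <ᵇ y) ∧ entry M x y) n

  hasSmaller-intro : ∀ {x y} → y < x → y ≈ x → hasSmaller x ≡ true
  hasSmaller-intro {x} {y} = anyBelow-intro (λ y → entry M y x) x y

  hasSmaller-elim : ∀ {x} → hasSmaller x ≡ true → Σ ℕ λ y → y < x × y ≈ x
  hasSmaller-elim {x} = anyBelow-elim (λ y → entry M y x) x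

  hasLarger-intro : ∀ {x y} → x < y → x ≈ y → hasLarger x ≡ true
  hasLarger-intro {x} {y} x<y x≈y =
    anyBelow-intro (λ y → (x <ᵇ y) ∧ entry M x y) n y (≈⇒<ʳ x≈y) (cong₂ _∧_ (Equivalence.to T-≡ (<⇒<ᵇ x<y)) x≈y)

  hasLarger-elim : ∀ {x} → hasLarger x ≡ true → Σ ℕ λ y → x < y × x ≈ y
  hasLarger-elim {x} larger with anyBelow-elim (λ y → (x <ᵇ y) ∧ entry M x y) n larger
  ... | y , _ , x<ᵇy∧x≈y with x <ᵇ y in x<ᵇy
  ...   | true = y , <ᵇ⇒< x y (Equivalence.from T-≡ x<ᵇy) , x<ᵇy∧x≈y

  hasSmaller⇒< : ∀ {x} → hasSmaller x ≡ true → x < n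
  hasSmaller⇒< smaller = ≈⇒<ʳ (proj₂ (proj₂ (hasSmaller-elim smaller)))

  hasLarger⇒< : ∀ {x} → hasLarger x ≡ true → x < n
  hasLarger⇒< larger = ≈⇒<ˡ (proj₂ (proj₂ (hasLarger-elim larger)))

  hasSmaller<hasLarger⇒≈ : ∀ {x y} → x < y → hasSmaller x ≡ true → hasLarger y ≡ true → x ≈ y
  hasSmaller<hasLarger⇒≈ x<y smaller larger with hasSmaller-elim smaller | hasLarger-elim larger
  ... | _ , w<x , w≈x | _ , y<z , y≈z = mates-between w<x x<y y<z w≈x y≈z

  inSupport isOpener isMiddle isCloser : ℕ → Bool
  inSupport x = hasSmaller x ∨ hasLarger x
  isOpener x = not (hasSmaller x) ∧ hasLarger x
  isMiddle x = hasSmaller x ∧ hasLarger x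
  isCloser x = hasSmaller x ∧ not (hasLarger x)

  f d g : ℕ
  f = count isOpener n
  d = count isMiddle n
  g = count isCloser n

  supportRank : ℕ → ℕ
  supportRank = count inSupport

  supportRank-split : ∀ x → supportRank x ≡ count isOpener x + count hasSmaller x
  supportRank-split x = count-+ inSupport isOpener hasSmaller x (λ y → split (hasSmaller y) (hasLarger y))
    where
    split : ∀ s l → 𝟙 (s ∨ l) ≡ 𝟙 (not s ∧ l) + 𝟙 s
    split true _ = refl
    split false true = refl
    split false false = refl

  hasSmaller-split : ∀ x → count hasSmaller x ≡ count isMiddle x + count isCloser x
  hasSmaller-split x = count-+ hasSmaller isMiddle isCloser x (λ y → split (hasSmaller y) (hasLarger y))
    where
    split : ∀ s l → 𝟙 s ≡ 𝟙 (s ∧ l) + 𝟙 (s ∧ not l)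
    split true true = refl
    split true false = refl
    split false _ = refl

  inSupport⇒< : ∀ {x} → inSupport x ≡ true → x < n
  inSupport⇒< {x} x∈ with hasSmaller x in smaller
  ... | true = hasSmaller⇒< smaller
  ... | false = hasLarger⇒< x∈

  no-smaller-before-opener : ∀ {x} → hasSmaller x ≡ false → hasLarger x ≡ true → ∀ y → y < x → hasSmaller y ≡ false
  no-smaller-before-opener x-smaller x-larger y y<x with hasSmaller y in y-smaller
  ... | false = refl
  ... | true = ⊥-elim (true≢false (hasSmaller-intro y<x (hasSmaller<hasLarger⇒≈ y<x y-smaller x-larger)) x-smaller)

  no-closer-before : ∀ {x} → hasLarger x ≡ true → ∀ y → y < x → isCloser y ≡ false
  no-closer-before x-larger y y<x with hasSmaller y in y-smaller | hasLarger y in y-larger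
  ... | false | _ = refl
  ... | true | true = refl
  ... | true | false = ⊥-elim (true≢false (hasLarger-intro y<x (hasSmaller<hasLarger⇒≈ y<x y-smaller x-larger)) y-larger)

  no-opener-after : ∀ {x} → hasSmaller x ≡ true → ∀ y → x ≤ y → isOpener y ≡ false
  no-opener-after {x} x-smaller y x≤y with m≤n⇒m<n∨m≡n x≤y
  ... | inj₂ refl rewrite x-smaller = refl
  ... | inj₁ x<y with hasSmaller y in y-smaller | hasLarger y in y-larger
  ...   | true | _ = refl
  ...   | false | false = refl
  ...   | false | true = ⊥-elim (true≢false (hasSmaller-intro x<y (hasSmaller<hasLarger⇒≈ x<y x-smaller y-larger)) y-smaller)

  no-middle-after-closer : ∀ {x} → hasSmaller x ≡ true → hasLarger x ≡ false → ∀ y → x ≤ y → isMiddle y ≡ false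
  no-middle-after-closer {x} x-smaller x-larger y x≤y with m≤n⇒m<n∨m≡n x≤y
  ... | inj₂ refl rewrite x-smaller | x-larger = refl
  ... | inj₁ x<y with hasSmaller y | hasLarger y in y-larger
  ...   | false | _ = refl
  ...   | true | false = refl
  ...   | true | true = ⊥-elim (true≢false (hasLarger-intro x<y (hasSmaller<hasLarger⇒≈ x<y x-smaller y-larger)) x-larger)

  openers-before : ∀ {x} → hasSmaller x ≡ true → count isOpener x ≡ f
  openers-before {x} x-smaller = count-stable isOpener x n (<⇒≤ (hasSmaller⇒< x-smaller)) (λ y x≤y _ → no-opener-after x-smaller y x≤y)

  supportRank-opener : ∀ {x} → hasSmaller x ≡ false → hasLarger x ≡ true → supportRank x < f
  supportRank-opener {x} x-smaller x-larger = begin-strict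
    supportRank x                           ≡⟨ supportRank-split x ⟩
    count isOpener x + count hasSmaller x   ≡⟨ cong (count isOpener x +_) (count-none hasSmaller x (no-smaller-before-opener x-smaller x-larger)) ⟩
    count isOpener x + 0                    ≡⟨ +-identityʳ _ ⟩
    count isOpener x                        <⟨ count-strict isOpener opener (hasLarger⇒< x-larger) ⟩
    f                                       ∎
    where
    open ≤-Reasoning
    opener : isOpener x ≡ true
    opener rewrite x-smaller | x-larger = refl

  supportRank-middle : ∀ {x} → hasSmaller x ≡ true → hasLarger x ≡ true → f ≤ supportRank x × supportRank x < f + d
  supportRank-middle {x} x-smaller x-larger =
    subst (λ r → f ≤ r × r < f + d) (sym rank≡) (m≤m+n f _ , +-monoʳ-< f (count-strict isMiddle middle (hasLarger⇒< x-larger)))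
    where
    middle : isMiddle x ≡ true
    middle rewrite x-smaller | x-larger = refl
    rank≡ : supportRank x ≡ f + count isMiddle x
    rank≡ = begin
      supportRank x                                  ≡⟨ supportRank-split x ⟩
      count isOpener x + count hasSmaller x          ≡⟨ cong₂ _+_ (openers-before {x} x-smaller) (hasSmaller-split x) ⟩
      f + (count isMiddle x + count isCloser x)      ≡⟨ cong (λ c → f + (count isMiddle x + c)) (count-none isCloser x (no-closer-before x-larger)) ⟩
      f + (count isMiddle x + 0)                     ≡⟨ cong (f +_) (+-identityʳ _) ⟩
      f + count isMiddle x                           ∎
      where open ≡-Reasoning

  supportRank-closer : ∀ {x} → hasSmaller x ≡ true → hasLarger x ≡ false → f + d ≤ supportRank x
  supportRank-closer {x} x-smaller x-larger = begin
    f + d                                          ≤⟨ m≤m+n (f + d) (count isCloser x) ⟩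
    f + d + count isCloser x                       ≡⟨ +-assoc f d _ ⟩
    f + (d + count isCloser x)                     ≡⟨ cong₂ (λ o m → o + (m + count isCloser x)) (openers-before {x} x-smaller) middles-before ⟨
    count isOpener x + (count isMiddle x + count isCloser x) ≡⟨ cong (count isOpener x +_) (hasSmaller-split x) ⟨
    count isOpener x + count hasSmaller x          ≡⟨ supportRank-split x ⟨
    supportRank x                                  ∎
    where
    open ≤-Reasoning
    middles-before : count isMiddle x ≡ d
    middles-before = count-stable isMiddle x n (<⇒≤ (hasSmaller⇒< x-smaller)) (λ y x≤y _ → no-middle-after-closer x-smaller x-larger y x≤y)

  opener⁻ : ∀ {x} → isOpener x ≡ true → hasSmaller x ≡ false × hasLarger x ≡ true
  opener⁻ {x} opener with hasSmaller x | hasLarger x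
  ... | false | true = refl , refl

  closer⁻ : ∀ {x} → isCloser x ≡ true → hasSmaller x ≡ true × hasLarger x ≡ false
  closer⁻ {x} closer with hasSmaller x | hasLarger x
  ... | true | false = refl , refl

  opener-by-rank : ∀ {x} → inSupport x ≡ true → supportRank x < f → hasSmaller x ≡ false × hasLarger x ≡ true
  opener-by-rank {x} x∈ r<f with hasSmaller x in s | hasLarger x in l
  ... | false | true = refl , refl
  ... | true | true = ⊥-elim (<⇒≱ r<f (proj₁ (supportRank-middle s l)))
  ... | true | false = ⊥-elim (<⇒≱ r<f (≤-trans (m≤m+n f d) (supportRank-closer s l)))

  middle-by-rank : ∀ {x} → inSupport x ≡ true → f ≤ supportRank x → supportRank x < f + d →
    hasSmaller x ≡ true × hasLarger x ≡ true
  middle-by-rank {x} x∈ f≤r r<f+d with hasSmaller x in s | hasLarger x in l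
  ... | true | true = refl , refl
  ... | false | true = ⊥-elim (<⇒≱ (supportRank-opener s l) f≤r)
  ... | true | false = ⊥-elim (<⇒≱ r<f+d (supportRank-closer s l))

  closer-by-rank : ∀ {x} → inSupport x ≡ true → f + d ≤ supportRank x → hasSmaller x ≡ true × hasLarger x ≡ false
  closer-by-rank {x} x∈ f+d≤r with hasSmaller x in s | hasLarger x in l
  ... | true | false = refl , refl
  ... | false | true = ⊥-elim (<⇒≱ (supportRank-opener s l) (≤-trans (m≤m+n f d) f+d≤r))
  ... | true | true = ⊥-elim (<⇒≱ (proj₂ (supportRank-middle s l)) f+d≤r)

  openers-≈⇒≡ : ∀ {x y} → hasSmaller x ≡ false → hasSmaller y ≡ false → x ≈ y → x ≡ y
  openers-≈⇒≡ {x} {y} x-smaller y-smaller x≈y with <-cmp x y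
  ... | tri< x<y _ _ = ⊥-elim (true≢false (hasSmaller-intro x<y x≈y) y-smaller)
  ... | tri≈ _ x≡y _ = x≡y
  ... | tri> _ _ y<x = ⊥-elim (true≢false (hasSmaller-intro y<x (≈-sym x≈y)) x-smaller)

  closers-≈⇒≡ : ∀ {x y} → hasLarger x ≡ false → hasLarger y ≡ false → x ≈ y → x ≡ y
  closers-≈⇒≡ {x} {y} x-larger y-larger x≈y with <-cmp x y
  ... | tri< x<y _ _ = ⊥-elim (true≢false (hasLarger-intro x<y x≈y) x-larger)
  ... | tri≈ _ x≡y _ = x≡y
  ... | tri> _ _ y<x = ⊥-elim (true≢false (hasLarger-intro y<x (≈-sym x≈y)) y-larger)

  blockMin : ℕ → ℕ
  blockMin x = least (λ y → entry M y x) (suc x)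

  module _ {x} (x<n : x < n) where

    blockMin-spec : blockMin x ≤ x × blockMin x ≈ x × (∀ z → z < blockMin x → entry M z x ≡ false)
    blockMin-spec with least-spec (λ y → entry M y x) (suc x) x (n<1+n x) (≈-refl x<n)
    ... | min≤x , min≈x , below = min≤x , min≈x , below

    blockMin-≈ : blockMin x ≈ x
    blockMin-≈ = proj₁ (proj₂ blockMin-spec)

    blockMin-minimal : ∀ {z} → z ≈ x → blockMin x ≤ z
    blockMin-minimal {z} z≈x = ≮⇒≥ (λ z<min → true≢false z≈x (proj₂ (proj₂ blockMin-spec) z z<min))

    blockMin<n : blockMin x < n
    blockMin<n = ≤-<-trans (proj₁ blockMin-spec) x<n

    blockMin-hasSmaller : hasSmaller (blockMin x) ≡ false
    blockMin-hasSmaller with hasSmaller (blockMin x) in s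
    ... | false = refl
    ... | true with hasSmaller-elim s
    ...   | z , z<min , z≈min = ⊥-elim (<⇒≱ z<min (blockMin-minimal (≈-trans z≈min blockMin-≈)))

    blockMin-fixed : hasSmaller x ≡ false → blockMin x ≡ x
    blockMin-fixed x-smaller with m≤n⇒m<n∨m≡n (proj₁ blockMin-spec)
    ... | inj₂ min≡x = min≡x
    ... | inj₁ min<x = ⊥-elim (true≢false (hasSmaller-intro min<x blockMin-≈) x-smaller)

  blockMin-cong : ∀ {x y} → x ≈ y → blockMin x ≡ blockMin y
  blockMin-cong x≈y = ≤-antisym (blockMin-minimal (≈⇒<ˡ x≈y) (≈-trans (blockMin-≈ (≈⇒<ʳ x≈y)) (≈-sym x≈y)))
                                (blockMin-minimal (≈⇒<ʳ x≈y) (≈-trans (blockMin-≈ (≈⇒<ˡ x≈y)) x≈y))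

  blockMin-hasLarger : ∀ {x} → inSupport x ≡ true → hasLarger (blockMin x) ≡ true
  blockMin-hasLarger {x} x∈ with m≤n⇒m<n∨m≡n (proj₁ (blockMin-spec (inSupport⇒< x∈)))
  ... | inj₁ min<x = hasLarger-intro min<x (blockMin-≈ (inSupport⇒< x∈))
  ... | inj₂ min≡x = subst (λ m → hasLarger m ≡ true) (sym min≡x) (minimum-hasLarger x∈)
    where
    minimum-hasLarger : inSupport x ≡ true → hasLarger x ≡ true
    minimum-hasLarger x∈ with bool-cases (hasSmaller x)
    ... | inj₂ s = subst (λ b → b ∨ hasLarger x ≡ true) s x∈
    ... | inj₁ s with hasSmaller-elim s
    ...   | z , z<x , z≈x = ⊥-elim (<⇒≱ z<x (subst (_≤ z) min≡x (blockMin-minimal (inSupport⇒< x∈) z≈x)))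

  blockMax : ℕ → ℕ
  blockMax x = greatest (entry M x) n

  module _ {x} (x<n : x < n) where

    blockMax-spec : x ≤ blockMax x × blockMax x < n × x ≈ blockMax x
    blockMax-spec = greatest-spec (entry M x) n x x<n (≈-refl x<n)

    blockMax-≈ : x ≈ blockMax x
    blockMax-≈ = proj₂ (proj₂ blockMax-spec)

  blockMax-maximal : ∀ {x z} → x ≈ z → z ≤ blockMax x
  blockMax-maximal {x} {z} x≈z = proj₁ (greatest-spec (entry M x) n z (≈⇒<ʳ x≈z) x≈z)

  blockMax-closer : ∀ {x} → hasLarger x ≡ true → isCloser (blockMax x) ≡ true
  blockMax-closer {x} x-larger = closer⁺ max-hasSmaller max-hasLarger
    where
    x<n = hasLarger⇒< x-larger
    closer⁺ : ∀ {y} → hasSmaller y ≡ true → hasLarger y ≡ false → isCloser y ≡ true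
    closer⁺ s l rewrite s | l = refl
    max-hasSmaller : hasSmaller (blockMax x) ≡ true
    max-hasSmaller with hasLarger-elim x-larger
    ... | z , x<z , x≈z = hasSmaller-intro (<-≤-trans x<z (blockMax-maximal x≈z)) (blockMax-≈ x<n)
    max-hasLarger : hasLarger (blockMax x) ≡ false
    max-hasLarger with bool-cases (hasLarger (blockMax x))
    ... | inj₂ l = l
    ... | inj₁ l with hasLarger-elim l
    ...   | w , max<w , max≈w = ⊥-elim (<⇒≱ max<w (blockMax-maximal (≈-trans (blockMax-≈ x<n) max≈w)))

  blockMin-opener : ∀ {x} → inSupport x ≡ true → isOpener (blockMin x) ≡ true
  blockMin-opener {x} x∈ rewrite blockMin-hasSmaller (inSupport⇒< x∈) | blockMin-hasLarger x∈ = refl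

  hasSmaller⇒inSupport : ∀ {x} → hasSmaller x ≡ true → inSupport x ≡ true
  hasSmaller⇒inSupport s rewrite s = refl

  hasLarger⇒inSupport : ∀ {x} → hasLarger x ≡ true → inSupport x ≡ true
  hasLarger⇒inSupport {x} l rewrite l = ∨-zeroʳ (hasSmaller x)

  -- every non-singleton block has exactly one minimum (an opener) and one maximum (a closer)
  g≡f : g ≡ f
  g≡f = ≤-antisym
    (count-≤-injection isCloser isOpener n blockMin
      (λ x x<n closer → blockMin<n x<n , blockMin-opener {x} (hasSmaller⇒inSupport {x} (proj₁ (closer⁻ {x} closer))))
      (λ x y x-closer y-closer min≡ → closers-≈⇒≡ (proj₂ (closer⁻ {x} x-closer)) (proj₂ (closer⁻ {y} y-closer))
         (≈-trans (≈-sym (blockMin-≈ (closer⇒< {x} x-closer))) (subst (_≈ y) (sym min≡) (blockMin-≈ (closer⇒< {y} y-closer))))))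
    (count-≤-injection isOpener isCloser n blockMax
      (λ x x<n opener → proj₁ (proj₂ (blockMax-spec x<n)) , blockMax-closer {x} (proj₂ (opener⁻ {x} opener)))
      (λ x y x-opener y-opener max≡ → openers-≈⇒≡ (proj₁ (opener⁻ {x} x-opener)) (proj₁ (opener⁻ {y} y-opener))
         (≈-trans (blockMax-≈ (opener⇒< {x} x-opener)) (subst (_≈ y) (sym max≡) (≈-sym (blockMax-≈ (opener⇒< {y} y-opener)))))))
    where
    closer⇒< : ∀ {x} → isCloser x ≡ true → x < n
    closer⇒< {x} c = hasSmaller⇒< (proj₁ (closer⁻ {x} c))
    opener⇒< : ∀ {x} → isOpener x ≡ true → x < n
    opener⇒< {x} o = hasLarger⇒< (proj₂ (opener⁻ {x} o))

  middles-≈ : ∀ {x y} → hasSmaller x ≡ true × hasLarger x ≡ true → hasSmaller y ≡ true × hasLarger y ≡ true → x ≈ y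
  middles-≈ {x} {y} (x-smaller , x-larger) (y-smaller , y-larger) with <-cmp x y
  ... | tri< x<y _ _ = hasSmaller<hasLarger⇒≈ x<y x-smaller y-larger
  ... | tri≈ _ refl _ = ≈-refl (hasSmaller⇒< x-smaller)
  ... | tri> _ _ y<x = ≈-sym (hasSmaller<hasLarger⇒≈ y<x y-smaller x-larger)

module Encoding {n} (M : RelMat n) (M-isPartition : IsSetPartition M) (avoids : Avoids M p12/34) where
  open Structure M M-isPartition avoids

  supportSize : supportRank n ≡ f + (d + f)
  supportSize = begin
    supportRank n                          ≡⟨ supportRank-split n ⟩
    count isOpener n + count hasSmaller n  ≡⟨ cong (f +_) (hasSmaller-split n) ⟩
    f + (d + g)                            ≡⟨ cong (λ c → f + (d + c)) g≡f ⟩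
    f + (d + f)                            ∎
    where open ≡-Reasoning

  module _ r (r<size : r < supportRank n) where

    element : ℕ
    element = proj₁ (count-select inSupport n r r<size)

    element-∈ : inSupport element ≡ true
    element-∈ = proj₁ (proj₂ (proj₂ (count-select inSupport n r r<size)))

    supportRank-element : supportRank element ≡ r
    supportRank-element = proj₂ (proj₂ (proj₂ (count-select inSupport n r r<size)))

    element-unique : ∀ {x} → inSupport x ≡ true → supportRank x ≡ r → element ≡ x
    element-unique x∈ rank≡r = count-injective inSupport element-∈ x∈ (trans supportRank-element (sym rank≡r))

  supportRank-blockMin<f : ∀ {x} → inSupport x ≡ true → supportRank (blockMin x) < f
  supportRank-blockMin<f x∈ = supportRank-opener (blockMin-hasSmaller (inSupport⇒< x∈)) (blockMin-hasLarger x∈)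

  ≈-by-blockMin : ∀ {x y} → inSupport x ≡ true → inSupport y ≡ true →
    supportRank (blockMin x) ≡ supportRank (blockMin y) → x ≈ y
  ≈-by-blockMin {x} {y} x∈ y∈ rank≡ =
    ≈-trans (≈-sym (blockMin-≈ (inSupport⇒< x∈))) (subst (_≈ y) (sym min≡) (blockMin-≈ (inSupport⇒< y∈)))
    where
    min≡ : blockMin x ≡ blockMin y
    min≡ = count-injective inSupport (hasLarger⇒inSupport (blockMin-hasLarger x∈)) (hasLarger⇒inSupport (blockMin-hasLarger y∈)) rank≡

  closer<size : ∀ q → q < f → f + d + q < supportRank n
  closer<size q q<f = subst (f + d + q <_) (sym supportSize) (subst (_< f + (d + f)) (sym (+-assoc f d q)) (+-monoʳ-< f (+-monoʳ-< d q<f)))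

  closer : Fin f → ℕ
  closer q = element (f + d + toℕ q) (closer<size (toℕ q) (toℕ<n q))

  S : Vec Bool n
  S = tabulate (λ j → inSupport (toℕ j))

  τ : Vec (Fin f) f
  τ = tabulate (λ q → fromℕ< (supportRank-blockMin<f (element-∈ _ (closer<size (toℕ q) (toℕ<n q)))))

  τ-lookup : ∀ q → toℕ (lookup τ q) ≡ supportRank (blockMin (closer q))
  τ-lookup q = trans (cong toℕ (lookup∘tabulate _ q)) (toℕ-fromℕ< _)

  τ-injective : Injectiveᵛ τ
  τ-injective q q′ τq≡τq′ = toℕ-injective (+-cancelˡ-≡ (f + d) _ _ (begin
    f + d + toℕ q                 ≡⟨ supportRank-element _ _ ⟨
    supportRank (closer q)        ≡⟨ cong supportRank closer≡ ⟩
    supportRank (closer q′)       ≡⟨ supportRank-element _ _ ⟩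
    f + d + toℕ q′                ∎))
    where
    open ≡-Reasoning
    is-closer : ∀ q → hasLarger (closer q) ≡ false
    is-closer q = proj₂ (closer-by-rank (element-∈ _ _) (subst (f + d ≤_) (sym (supportRank-element _ _)) (m≤m+n (f + d) (toℕ q))))
    closer≡ : closer q ≡ closer q′
    closer≡ = closers-≈⇒≡ (is-closer q) (is-closer q′) (≈-by-blockMin (element-∈ _ _) (element-∈ _ _)
      (trans (sym (τ-lookup q)) (trans (cong toℕ τq≡τq′) (τ-lookup q′))))

  middle<size : 0 < d → f < supportRank n
  middle<size 0<d = subst (f <_) (sym supportSize) (m<m+n f (≤-trans 0<d (m≤m+n d f)))

  firstMiddleBlock : Dec (0 < d) → ℕ
  firstMiddleBlock (yes 0<d) = supportRank (blockMin (element f (middle<size 0<d)))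
  firstMiddleBlock (no _) = 0

  -- the block of the middle elements, or the junk value 0 when there are none
  i : ℕ
  i = firstMiddleBlock (0 <? d)

  firstMiddleBlock-yes : ∀ d? 0<d → firstMiddleBlock d? ≡ supportRank (blockMin (element f (middle<size 0<d)))
  firstMiddleBlock-yes (yes 0<d′) 0<d = cong (λ p → supportRank (blockMin (element f (middle<size p)))) (<-irrelevant 0<d′ 0<d)
  firstMiddleBlock-yes (no 0≮d) 0<d = ⊥-elim (0≮d 0<d)

  firstMiddleBlock-no : ∀ d? → d ≡ 0 → firstMiddleBlock d? ≡ 0
  firstMiddleBlock-no (yes 0<d) d≡0 = ⊥-elim (<-irrefl (sym d≡0) 0<d)
  firstMiddleBlock-no (no _) _ = refl

  i-unused : d ≡ 0 → i ≡ 0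
  i-unused = firstMiddleBlock-no (0 <? d)

  i<f : 0 < d → i < f
  i<f 0<d = subst (_< f) (sym (firstMiddleBlock-yes (0 <? d) 0<d)) (supportRank-blockMin<f (element-∈ f (middle<size 0<d)))

  encode : Code n
  encode = mk f d S τ i

  member-S : ∀ x → member S x ≡ inSupport x
  member-S x with x <? n
  ... | yes x<n = member-tabulate inSupport x x<n
  ... | no x≮n with bool-cases (member S x) | bool-cases (inSupport x)
  ...   | inj₁ x∈S | _ = ⊥-elim (x≮n (member⇒< S x x∈S))
  ...   | inj₂ _ | inj₁ x∈ = ⊥-elim (x≮n (inSupport⇒< x∈))
  ...   | inj₂ x∉S | inj₂ x∉ = trans x∉S (sym x∉)

  rank-S : ∀ x → rank S x ≡ supportRank x
  rank-S x = count-cong (member S) inSupport x (λ y _ → member-S y)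

  weight-S : weight S ≡ f + f + d
  weight-S = begin
    weight S             ≡⟨ count-member S ⟨
    rank S n             ≡⟨ rank-S n ⟩
    supportRank n        ≡⟨ supportSize ⟩
    f + (d + f)          ≡⟨ cong (f +_) (+-comm d f) ⟩
    f + (f + d)          ≡⟨ +-assoc f f d ⟨
    f + f + d            ∎
    where open ≡-Reasoning

  closerIndex<f : ∀ {x} → inSupport x ≡ true → f + d ≤ supportRank x → supportRank x ∸ (f + d) < f
  closerIndex<f {x} x∈ f+d≤r = +-cancelʳ-< (f + d) _ _ (begin-strict
    supportRank x ∸ (f + d) + (f + d)  ≡⟨ m∸n+n≡m f+d≤r ⟩
    supportRank x                      <⟨ count-strict inSupport x∈ (inSupport⇒< x∈) ⟩
    supportRank n                      ≡⟨ supportSize ⟩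
    f + (d + f)                        ≡⟨ +-assoc f d f ⟨
    f + d + f                          ≡⟨ +-comm (f + d) f ⟩
    f + (f + d)                        ∎)
    where open ≤-Reasoning

  blockOfRank-supportRank-opener : ∀ {x} → inSupport x ≡ true → supportRank x < f →
    blockOfRank f d τ i (supportRank x) ≡ supportRank (blockMin x)
  blockOfRank-supportRank-opener {x} x∈ r<f = begin
    blockOfRank f d τ i (supportRank x)  ≡⟨ blockOfRank-opener f d τ i _ r<f ⟩
    supportRank x                        ≡⟨ cong supportRank (blockMin-fixed (inSupport⇒< x∈) (proj₁ (opener-by-rank x∈ r<f))) ⟨
    supportRank (blockMin x)             ∎
    where open ≡-Reasoning

  blockOfRank-supportRank-middle : ∀ {x} → inSupport x ≡ true → f ≤ supportRank x → supportRank x < f + d →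
    blockOfRank f d τ i (supportRank x) ≡ supportRank (blockMin x)
  blockOfRank-supportRank-middle {x} x∈ f≤r r<f+d = begin
    blockOfRank f d τ i (supportRank x)  ≡⟨ blockOfRank-middle f d τ i _ f≤r r<f+d ⟩
    i                                    ≡⟨ firstMiddleBlock-yes (0 <? d) 0<d ⟩
    supportRank (blockMin m)             ≡⟨ cong supportRank (blockMin-cong (middles-≈ (middle-by-rank x∈ f≤r r<f+d) m-middle)) ⟨
    supportRank (blockMin x)             ∎
    where
    open ≡-Reasoning
    0<d = middle⇒0<d f≤r r<f+d
    m = element f (middle<size 0<d)
    m-middle = middle-by-rank (element-∈ f _) (≤-reflexive (sym (supportRank-element f _)))
                 (subst (_< f + d) (sym (supportRank-element f _)) (m<m+n f 0<d))

  blockOfRank-supportRank-closer : ∀ {x} → inSupport x ≡ true → f + d ≤ supportRank x →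
    blockOfRank f d τ i (supportRank x) ≡ supportRank (blockMin x)
  blockOfRank-supportRank-closer {x} x∈ f+d≤r = begin
    blockOfRank f d τ i (supportRank x)               ≡⟨ blockOfRank-closer f d τ i _ f+d≤r ⟩
    lookupℕ τ index                                   ≡⟨ lookupℕ-< τ index index<f ⟩
    toℕ (lookup τ (fromℕ< index<f))                   ≡⟨ τ-lookup (fromℕ< index<f) ⟩
    supportRank (blockMin (closer (fromℕ< index<f)))  ≡⟨ cong (supportRank ∘ blockMin) closer≡x ⟩
    supportRank (blockMin x)                          ∎
    where
    open ≡-Reasoning
    index = supportRank x ∸ (f + d)
    index<f : index < f
    index<f = closerIndex<f x∈ f+d≤r
    closer≡x : closer (fromℕ< index<f) ≡ x
    closer≡x = element-unique _ _ x∈ (begin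
      supportRank x                 ≡⟨ m∸n+n≡m f+d≤r ⟨
      index + (f + d)               ≡⟨ +-comm index (f + d) ⟩
      f + d + index                 ≡⟨ cong (f + d +_) (toℕ-fromℕ< index<f) ⟨
      f + d + toℕ (fromℕ< index<f)  ∎)

  blockOfRank-supportRank : ∀ x → inSupport x ≡ true → blockOfRank f d τ i (supportRank x) ≡ supportRank (blockMin x)
  blockOfRank-supportRank x x∈ = by-region (supportRank x <? f) (supportRank x <? f + d)
    where
    by-region : Dec (supportRank x < f) → Dec (supportRank x < f + d) →
      blockOfRank f d τ i (supportRank x) ≡ supportRank (blockMin x)
    by-region (yes r<f) _ = blockOfRank-supportRank-opener x∈ r<f
    by-region (no r≮f) (yes r<f+d) = blockOfRank-supportRank-middle x∈ (≮⇒≥ r≮f) r<f+d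
    by-region (no _) (no r≮f+d) = blockOfRank-supportRank-closer x∈ (≮⇒≥ r≮f+d)

  label-encode-∈ : ∀ {x} → inSupport x ≡ true → label encode x ≡ block (supportRank (blockMin x))
  label-encode-∈ {x} x∈ = trans (label-∈ encode x (trans (member-S x) x∈))
    (cong block (trans (cong (blockOfRank f d τ i) (rank-S x)) (blockOfRank-supportRank x x∈)))

  label-encode-∉ : ∀ {x} → inSupport x ≡ false → label encode x ≡ singleton x
  label-encode-∉ {x} x∉ = label-∉ encode x (trans (member-S x) x∉)

  -- The case splits below use local functions: `with` would normalise `label encode x`, at prohibitive cost.
  ≈⇒label≡ : ∀ {x y} → x ≈ y → label encode x ≡ label encode y
  ≈⇒label≡ {x} {y} x≈y = by-order (<-cmp x y)
    where
    same-label : inSupport x ≡ true → inSupport y ≡ true → label encode x ≡ label encode y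
    same-label x∈ y∈ =
      trans (label-encode-∈ {x} x∈) (trans (cong (block ∘ supportRank) (blockMin-cong x≈y)) (sym (label-encode-∈ {y} y∈)))
    by-order : Tri (x < y) (x ≡ y) (x > y) → label encode x ≡ label encode y
    by-order (tri≈ _ refl _) = refl
    by-order (tri< x<y _ _) =
      same-label (hasLarger⇒inSupport {x} (hasLarger-intro x<y x≈y)) (hasSmaller⇒inSupport {y} (hasSmaller-intro x<y x≈y))
    by-order (tri> _ _ y<x) =
      same-label (hasSmaller⇒inSupport {x} (hasSmaller-intro y<x (≈-sym x≈y))) (hasLarger⇒inSupport {y} (hasLarger-intro y<x (≈-sym x≈y)))

  block≢singleton : ∀ {a b} → block a ≢ singleton b
  block≢singleton ()

  label≡⇒≈ : ∀ {x y} → x < n → label encode x ≡ label encode y → x ≈ y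
  label≡⇒≈ {x} {y} x<n label≡ = by-support (bool-cases (inSupport x)) (bool-cases (inSupport y))
    where
    by-support : inSupport x ≡ true ⊎ inSupport x ≡ false → inSupport y ≡ true ⊎ inSupport y ≡ false → x ≈ y
    by-support (inj₁ x∈) (inj₁ y∈) =
      ≈-by-blockMin x∈ y∈ (block-injective (trans (sym (label-encode-∈ {x} x∈)) (trans label≡ (label-encode-∈ {y} y∈))))
    by-support (inj₁ x∈) (inj₂ y∉) =
      ⊥-elim (block≢singleton (trans (sym (label-encode-∈ {x} x∈)) (trans label≡ (label-encode-∉ {y} y∉))))
    by-support (inj₂ x∉) (inj₁ y∈) =
      ⊥-elim (block≢singleton (trans (sym (label-encode-∈ {y} y∈)) (trans (sym label≡) (label-encode-∉ {x} x∉))))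
    by-support (inj₂ x∉) (inj₂ y∉) =
      subst (x ≈_) (singleton-injective (trans (sym (label-encode-∉ {x} x∉)) (trans label≡ (label-encode-∉ {y} y∉)))) (≈-refl x<n)

  decode-encode : decode encode ≡ M
  decode-encode = lookup-extensionality _ _ λ x → lookup-extensionality _ _ λ y →
    trans (decode-lookup encode x y) (trans (label-test (toℕ<n x) (bool-cases (entry M (toℕ x) (toℕ y)))) (entry-lookup M x y))
    where
    label-test : ∀ {x y} → x < n → entry M x y ≡ true ⊎ entry M x y ≡ false → ⌊ label encode x ≟ᴸ label encode y ⌋ ≡ entry M x y
    label-test {x} {y} x<n (inj₁ x≈y) = trans (isYes≗does _) (trans (dec-true (label encode x ≟ᴸ label encode y) (≈⇒label≡ {x} {y} x≈y)) (sym x≈y))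
    label-test {x} {y} x<n (inj₂ x≉y) =
      trans (isYes≗does _) (trans (dec-false (label encode x ≟ᴸ label encode y) (λ label≡ → true≢false (label≡⇒≈ {x} {y} x<n label≡) x≉y)) (sym x≉y))

module DecodeInjective where

  Refines : ∀ {n} → Code n → Code n → Set
  Refines {n} c₁ c₂ = ∀ {x y} → x < n → y < n → label c₁ x ≡ label c₁ y → label c₂ x ≡ label c₂ y

  decode⇒refines : ∀ {n} (c₁ c₂ : Code n) → decode c₁ ≡ decode c₂ → Refines c₁ c₂
  decode⇒refines c₁ c₂ decode≡ {x} {y} x<n y<n same₁ =
    subst₂ (λ a b → label c₂ a ≡ label c₂ b) (toℕ-fromℕ< x<n) (toℕ-fromℕ< y<n)
      (∼-decode⇒label≡ c₂ _ _ (subst (λ M → fromℕ< x<n ∼[ M ] fromℕ< y<n) decode≡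
        (label≡⇒∼-decode c₁ _ _ (subst₂ (λ a b → label c₁ a ≡ label c₁ b) (sym (toℕ-fromℕ< x<n)) (sym (toℕ-fromℕ< y<n)) same₁))))

  support-⊆ : ∀ {n} {c₁ c₂ : Code n} → Valid c₁ → Refines c₁ c₂ → ∀ x → member (Code.S c₁) x ≡ true → member (Code.S c₂) x ≡ true
  support-⊆ {c₁ = c₁} {c₂} valid₁ refines x x∈S₁ with ValidCode.partner valid₁ x x∈S₁
  ... | y , y≢x , y<n , same₁ = label≡⇒∈ c₂ (λ x≡y → y≢x (sym x≡y)) (sym (refines y<n (member⇒< (Code.S c₁) x x∈S₁) same₁))

  support-≡ : ∀ {n} {c₁ c₂ : Code n} → Valid c₁ → Valid c₂ → Refines c₁ c₂ → Refines c₂ c₁ → Code.S c₁ ≡ Code.S c₂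
  support-≡ {c₁ = c₁} {c₂} valid₁ valid₂ refines₁₂ refines₂₁ = lookup-extensionality _ _ λ j → begin
    lookup (Code.S c₁) j           ≡⟨ member-lookup (Code.S c₁) j ⟨
    member (Code.S c₁) (toℕ j)     ≡⟨ bool-antisym (support-⊆ {c₁ = c₁} {c₂} valid₁ refines₁₂ (toℕ j))
                                                   (support-⊆ {c₁ = c₂} {c₁} valid₂ refines₂₁ (toℕ j)) ⟩
    member (Code.S c₂) (toℕ j)     ≡⟨ member-lookup (Code.S c₂) j ⟩
    lookup (Code.S c₂) j           ∎
    where
    open ≡-Reasoning
    bool-antisym : ∀ {a b : Bool} → (a ≡ true → b ≡ true) → (b ≡ true → a ≡ true) → a ≡ b
    bool-antisym {false} {false} _ _ = refl
    bool-antisym {true} a⇒b _ = sym (a⇒b refl)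
    bool-antisym {false} {true} _ b⇒a = b⇒a refl

  -- the element of rank f₂ of the common support would be a block minimum for c₁ but not for c₂
  openers-≤ : ∀ {n f₁ d₁ f₂ d₂} {S : Vec Bool n} {τ₁ : Vec (Fin f₁) f₁} {τ₂ : Vec (Fin f₂) f₂} {i₁ i₂} →
    Valid (mk f₁ d₁ S τ₁ i₁) → Valid (mk f₂ d₂ S τ₂ i₂) → Refines (mk f₂ d₂ S τ₂ i₂) (mk f₁ d₁ S τ₁ i₁) → f₁ ≤ f₂
  openers-≤ {f₁ = f₁} {d₁} {f₂} {S = S} valid₁ valid₂ refines₂₁ = ≮⇒≥ λ f₂<f₁ →
    let f₂<2f₁+d₁ = openerRank<2f+d f₁ d₁ f₂<f₁
        x = atRank f₂ f₂<2f₁+d₁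
        x∈S = atRank∈S f₂ f₂<2f₁+d₁
        rank≡f₂ = rank-atRank f₂ f₂<2f₁+d₁
    in case ValidCode.smaller-partner valid₂ x x∈S (≤-reflexive (sym rank≡f₂)) of λ where
      (y , y<x , same₂) → opener-minimal x y x∈S (subst (_< f₁) (sym rank≡f₂) f₂<f₁) y<x
                            (refines₂₁ (<-trans y<x (atRank<n f₂ f₂<2f₁+d₁)) (atRank<n f₂ f₂<2f₁+d₁) same₂)
    where
    open ValidCode valid₁

  blockOfRank-refines : ∀ {n f d} {S : Vec Bool n} {τ₁ τ₂ : Vec (Fin f) f} {i₁ i₂} →
    Valid (mk f d S τ₁ i₁) → Refines (mk f d S τ₁ i₁) (mk f d S τ₂ i₂) →
    ∀ r s → r < f + f + d → s < f → blockOfRank f d τ₁ i₁ r ≡ s → blockOfRank f d τ₂ i₂ r ≡ s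
  blockOfRank-refines {f = f} {d} {S} {τ₁} {τ₂} {i₁} {i₂} valid₁ refines r s r<2f+d s<f r↦s = block-injective (begin
    block (blockOfRank f d τ₂ i₂ r)                ≡⟨ cong (block ∘ blockOfRank f d τ₂ i₂) (rank-atRank r r<2f+d) ⟨
    block (blockOfRank f d τ₂ i₂ (rank S x))       ≡⟨ label-∈ c₂ x (atRank∈S r r<2f+d) ⟨
    label c₂ x                                     ≡⟨ refines (atRank<n r r<2f+d) (atRank<n s s<2f+d) same₁ ⟩
    label c₂ y                                     ≡⟨ label-∈ c₂ y (atRank∈S s s<2f+d) ⟩
    block (blockOfRank f d τ₂ i₂ (rank S y))       ≡⟨ cong (block ∘ blockOfRank f d τ₂ i₂) (rank-atRank s s<2f+d) ⟩
    block (blockOfRank f d τ₂ i₂ s)                ≡⟨ cong block (blockOfRank-opener f d τ₂ i₂ s s<f) ⟩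
    block s                                        ∎)
    where
    open ≡-Reasoning
    open ValidCode valid₁
    c₂ = mk f d S τ₂ i₂
    s<2f+d = openerRank<2f+d f d s<f
    x = atRank r r<2f+d
    y = atRank s s<2f+d
    same₁ : label (mk f d S τ₁ i₁) x ≡ label (mk f d S τ₁ i₁) y
    same₁ = trans (label-atRank r r<2f+d) (trans (cong block (trans r↦s (sym (blockOfRank-opener f d τ₁ i₁ s s<f)))) (sym (label-atRank s s<2f+d)))

  matching-≡ : ∀ {n f d} {S : Vec Bool n} {τ₁ τ₂ : Vec (Fin f) f} {i₁ i₂} →
    Valid (mk f d S τ₁ i₁) → Refines (mk f d S τ₁ i₁) (mk f d S τ₂ i₂) → τ₁ ≡ τ₂
  matching-≡ {f = f} {d} {τ₁ = τ₁} {τ₂} {i₁} {i₂} valid₁ refines = lookup-extensionality τ₁ τ₂ λ q →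
    toℕ-injective (sym (trans (sym (blockOfRank-closerAt f d τ₂ i₂ q))
      (blockOfRank-refines valid₁ refines _ _ (closerRank<2f+d f d (toℕ<n q)) (toℕ<n (lookup τ₁ q)) (blockOfRank-closerAt f d τ₁ i₁ q))))

  middleBlock-≡ : ∀ {n f d} {S : Vec Bool n} {τ₁ τ₂ : Vec (Fin f) f} {i₁ i₂} →
    Valid (mk f d S τ₁ i₁) → Valid (mk f d S τ₂ i₂) → Refines (mk f d S τ₁ i₁) (mk f d S τ₂ i₂) → i₁ ≡ i₂
  middleBlock-≡ {f = f} {d} {τ₁ = τ₁} {τ₂} {i₁} {i₂} valid₁ valid₂ refines with d ≟ 0
  ... | yes d≡0 = trans (Valid.i-unused valid₁ d≡0) (sym (Valid.i-unused valid₂ d≡0))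
  ... | no d≢0 = sym (trans (sym (blockOfRank-middle f d τ₂ i₂ f ≤-refl f<f+d))
      (blockOfRank-refines valid₁ refines f i₁ (≤-trans f<f+d (+-monoˡ-≤ d (m≤m+n f f))) (Valid.i<f valid₁ (n≢0⇒n>0 d≢0))
        (blockOfRank-middle f d τ₁ i₁ f ≤-refl f<f+d)))
    where
    f<f+d = m<m+n f (n≢0⇒n>0 d≢0)

  refines-both-ways⇒≡ : ∀ {n} {c₁ c₂ : Code n} → Valid c₁ → Valid c₂ → Refines c₁ c₂ → Refines c₂ c₁ → c₁ ≡ c₂
  refines-both-ways⇒≡ {c₁ = c₁@(mk _ _ _ _ _)} {c₂@(mk _ _ _ _ _)} valid₁ valid₂ refines₁₂ refines₂₁ =
    same-support (support-≡ {c₁ = c₁} {c₂} valid₁ valid₂ refines₁₂ refines₂₁) valid₁ valid₂ refines₁₂ refines₂₁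
    where
    same-d : ∀ {n f d₁ d₂} {S : Vec Bool n} {τ₁ : Vec (Fin f) f} {τ₂ i₁ i₂} → d₁ ≡ d₂ →
      Valid (mk f d₁ S τ₁ i₁) → Valid (mk f d₂ S τ₂ i₂) → Refines (mk f d₁ S τ₁ i₁) (mk f d₂ S τ₂ i₂) →
      mk f d₁ S τ₁ i₁ ≡ mk f d₂ S τ₂ i₂
    same-d refl valid₁ valid₂ refines₁₂ = cong₂ (mk _ _ _) (matching-≡ valid₁ refines₁₂) (middleBlock-≡ valid₁ valid₂ refines₁₂)
    same-f : ∀ {n f₁ f₂ d₁ d₂} {S : Vec Bool n} {τ₁ : Vec (Fin f₁) f₁} {τ₂ : Vec (Fin f₂) f₂} {i₁ i₂} → f₁ ≡ f₂ →
      Valid (mk f₁ d₁ S τ₁ i₁) → Valid (mk f₂ d₂ S τ₂ i₂) → Refines (mk f₁ d₁ S τ₁ i₁) (mk f₂ d₂ S τ₂ i₂) →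
      mk f₁ d₁ S τ₁ i₁ ≡ mk f₂ d₂ S τ₂ i₂
    same-f {f₁ = f} refl valid₁ valid₂ refines₁₂ =
      same-d (+-cancelˡ-≡ (f + f) _ _ (trans (sym (Valid.weight-S valid₁)) (Valid.weight-S valid₂))) valid₁ valid₂ refines₁₂
    same-support : ∀ {n f₁ f₂ d₁ d₂} {S₁ S₂ : Vec Bool n} {τ₁ : Vec (Fin f₁) f₁} {τ₂ : Vec (Fin f₂) f₂} {i₁ i₂} → S₁ ≡ S₂ →
      Valid (mk f₁ d₁ S₁ τ₁ i₁) → Valid (mk f₂ d₂ S₂ τ₂ i₂) →
      Refines (mk f₁ d₁ S₁ τ₁ i₁) (mk f₂ d₂ S₂ τ₂ i₂) → Refines (mk f₂ d₂ S₂ τ₂ i₂) (mk f₁ d₁ S₁ τ₁ i₁) →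
      mk f₁ d₁ S₁ τ₁ i₁ ≡ mk f₂ d₂ S₂ τ₂ i₂
    same-support refl valid₁ valid₂ refines₁₂ refines₂₁ =
      same-f (≤-antisym (openers-≤ valid₁ valid₂ refines₂₁) (openers-≤ valid₂ valid₁ refines₁₂)) valid₁ valid₂ refines₁₂

  decode-injective : ∀ {n} {c₁ c₂ : Code n} → Valid c₁ → Valid c₂ → decode c₁ ≡ decode c₂ → c₁ ≡ c₂
  decode-injective {c₁ = c₁} {c₂} valid₁ valid₂ decode≡ =
    refines-both-ways⇒≡ valid₁ valid₂ (decode⇒refines c₁ c₂ decode≡) (decode⇒refines c₂ c₁ (sym decode≡))

open DecodeInjective

∈-map-decode⇒avoiding : ∀ {n} M → M ∈ map decode (codes n) → IsSetPartition M × Avoids M p12/34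
∈-map-decode⇒avoiding M M∈ with ∈-map⁻ decode M∈
... | c , c∈ , refl = decode-isSetPartition c , ValidCode.decode-avoids (∈-codes⇒valid c c∈)

avoiding⇒∈-map-decode : ∀ {n} M → IsSetPartition M × Avoids M p12/34 → M ∈ map decode (codes n)
avoiding⇒∈-map-decode M (M-isPartition , avoids) =
  subst (_∈ map decode (codes _)) decode-encode (∈-map⁺ decode (shape⇒∈-codes f d S τ i weight-S τ-injective i-unused i<f))
  where
  open Structure M M-isPartition avoids using (f; d)
  open Encoding M M-isPartition avoids

theorem4p6 : (n : ℕ) → 1 ≤ n →
    Σ (List (RelMat n)) λ L →
      Unique L ×
      ((M : RelMat n) → (M ∈ L) ⇔ (IsSetPartition M × Avoids M p12/34)) ×
      (length L ≡
        sumFromTo 0 (n / 2) (λ k →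
          (k !) * (n C (2 * k))
          + sumFromTo 3 (n ∸ 2 * k) (λ l → (n C (2 * k + l)) * (k !) * ((k + 1) ^ 2))))
theorem4p6 n _ =
  map decode (codes n) ,
  Unique-map-injectiveOn decode (Unique-codes n) (λ c∈ c′∈ → decode-injective (∈-codes⇒valid _ c∈) (∈-codes⇒valid _ c′∈)) ,
  (λ M → mk⇔ (∈-map-decode⇒avoiding M) (avoiding⇒∈-map-decode M)) ,
  trans (length-map decode (codes n)) (length-codes n)
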